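{- Assume the setting of the context. For every $e\in 2R$, $\mathbf{C}_e$ is a subcomplex of $\mathbf{C}_S$, and: 1) $\mathbf{C}_S=\bigoplus_{e\in 2R}\mathbf{C}_e$, and for each $T\subseteq S$ the projection $\mathbf{C}_S\to\mathbf{C}_T$ has kernel $\bigoplus_{e\in2R,\ \mathrm{supp}\, e\not\subseteq T}\mathbf{C}_e$ and restricts to an isomorphism $\bigoplus_{e\in2R,\ \mathrm{supp}\, e\subseteq T}\mathbf{C}_e\cong\mathbf{C}_T$; in particular $H^n(G_T,\mathbb{Z})\cong\bigoplus_{e\in 2R,\ \mathrm{supp}\, e\subseteq T}H^n(\mathbf{C}_e)$. 2) (a) If $\mathrm{supp}\, e\ne\emptyset$, let $m_e=\gcd\{\ell_i-1: i\in\mathrm{supp}\, e\}$. Then $\bigoplus_n H^n(\mathbf{C}_e)\cong(\mathbb{Z}/m_e\mathbb{Z})^{2^{|\mathrm{supp}\, e|-1}}$ and \[H^n(\mathbf{C}_e)\cong\begin{cases}(\mathbb{Z}/m_e\mathbb{Z})^{\binom{|\mathrm{supp}\, e|-1}{j}},& n=\deg e-j,\ 0\le j\le|\mathrm{supp}\, e|-1,\\ 0,&\text{otherwise}.\end{cases}\] (b) If $\mathrm{supp}\, e=\emptyset$, then $H^0(\mathbf{C}_e)=\mathbb{Z}$ and $H^n(\mathbf{C}_e)=0$ for $n\ne0$.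
   Context: $S$ is a finite set with a fixed total order; $\{\ell_i:i\in S\}$ distinct odd primes, $r=\prod\ell_i$, $G_S=\mathrm{Gal}(\mathbb{Q}(\mu_r)/\mathbb{Q})$, $G_i\subseteq G_S$ the inertia subgroup at $\ell_i$ (cyclic of order $\ell_i-1$) with generator $\sigma_i$, $N_i=\sum_{k=0}^{\ell_i-2}\sigma_i^k$, $G_T=\prod_{i\in T}G_i$. $R=\mathbb{Z}_{\ge0}^S$, $\deg e=\sum e_i$, $\mathrm{supp}\, e=\{i:e_i\neq0\}$; $2R$ = elements with all coordinates even. For each $i$, $P_{i,\bullet}$ is the $\mathbb{Z}[G_i]$-resolution of $\mathbb{Z}$ with $P_{ij}=\mathbb{Z}[G_i]$ and $\partial:P_{i,j+1}\to P_{ij}$ multiplication by $1-\sigma_i$ ($j$ even) or $N_i$ ($j$ odd); $\mathbf{C}_i=\mathrm{Hom}_{G_i}(P_{i,\bullet},\mathbb{Z})$ is the complex with $C_i^j=\mathbb{Z}$ ($j\ge0$) and differential $C_i^j\to C_i^{j+1}$ equal to $0$ for $j$ even and to multiplication by $\ell_i-1$ for $j$ odd. For $T\subseteq S$, $P_{T,\bullet}$ is the tensor product of the $P_{i,\bullet}$, $i\in T$, in the given order (a $\mathbb{Z}[G_T]$-resolution of $\mathbb{Z}$, with $P_{T,\bullet}\subseteq P_{S,\bullet}$ via the unit in degree $0$ of the missing factors), and $\mathbf{C}_T=\mathrm{Hom}_{G_T}(P_{T,\bullet},\mathbb{Z})$, identified with the ordered tensor product of the $\mathbf{C}_i$, $i\in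 T$; it has $\mathbb{Z}$-basis indexed by $e\in R$ with $\mathrm{supp}\, e\subseteq T$ (in degree $\deg e$), and $H^*(\mathbf{C}_T)=H^*(G_T,\mathbb{Z})$. The projection $\mathbf{C}_S\to\mathbf{C}_T$ is induced by $P_{T,\bullet}\subseteq P_{S,\bullet}$. For $i\in S$ and even $j\ge0$, $\mathbf{C}_i^{\bullet j}$ is the subcomplex of $\mathbf{C}_i$ equal to $C_i^0$ if $j=0$ and to $C_i^{j-1}\xrightarrow{\ell_i-1}C_i^j$ if $j>0$. For $e\in 2R$, $\mathbf{C}_e$ is the ordered tensor product of the $\mathbf{C}_i^{\bullet e_i}$ over $i\in S$. -}

module Defs where

open import Data.Nat using (ℕ; zero; suc; _+_; _≤_; _∸_; _⊔_)
open import Data.Nat.Divisibility using () renaming (_∣_ to _∣ℕ_)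
open import Data.Nat.GCD using (gcd)
open import Data.Integer using (ℤ; +_; 0ℤ; 1ℤ; -_) renaming (_+_ to _+ℤ_; _*_ to _*ℤ_; _-_ to _-ℤ_)
open import Data.Integer.Divisibility using () renaming (_∣_ to _∣ℤ_)
open import Data.Fin using (Fin; zero; suc)
open import Data.Fin.Subset using (Subset; _∈_)
open import Data.Vec using (Vec; []; _∷_; lookup; _[_]≔_) renaming (sum to sumV)
open import Data.List using (List; []; _∷_; upTo; allFin; concatMap; map; foldr)
open import Data.Product using (Σ; ∃; _×_; _,_)
open import Data.Sum using (_⊎_)
open import Data.Unit using (⊤)
open import Relation.Binary.PropositionalEquality using (_≡_; _≢_)
open import Relation.Nullary using (¬_)

-- S = Fin s with its natural order; the primes ℓ_i are
-- given as a vector ℓ : Vec ℕ s.  R = ℤ_{≥0}^S is represented by Vec ℕ s.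
-- A cochain of C_S (in any degree) is a coefficient function R → ℤ on
-- the dual basis {x_e}; the degree n is recorded by the equality used
-- (two cochains of degree n are equal iff they agree on all e with
-- deg e = n), so C_S^n ≅ ℤ^{e : deg e = n}.

Cochain : ℕ → Set
Cochain s = Vec ℕ s → ℤ

deg : ∀ {s} → Vec ℕ s → ℕ
deg = sumV

-- Σ_{k<i} e_k  (the Koszul sign exponent in the ordered tensor product)
prefix : ∀ {s} → Vec ℕ s → Fin s → ℕ
prefix (x ∷ xs) zero    = 0
prefix (x ∷ xs) (suc i) = x + prefix xs i

sgn : ℕ → ℤ
sgn zero    = 1ℤ
sgn (suc n) = - sgn n

-- the differential C_i^j → C_i^{j+1} of C_i (l = ℓ_i): 0 for j even, ℓ_i - 1 for j odd
cdiff : ℕ → ℕ → ℤ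
cdiff l zero          = 0ℤ
cdiff l (suc zero)    = + (l ∸ 1)
cdiff l (suc (suc j)) = cdiff l j

sumℤ : List ℤ → ℤ
sumℤ = foldr _+ℤ_ 0ℤ

dterm′ : ∀ {s} → Vec ℕ s → Cochain s → Vec ℕ s → Fin s → ℕ → ℤ
dterm′ ℓ f e i zero    = 0ℤ
dterm′ ℓ f e i (suc k) = sgn (prefix e i) *ℤ cdiff (lookup ℓ i) k *ℤ f (e [ i ]≔ k)

-- Differential of the ordered tensor product C_S = ⊗_i C_i:
--   d x_e = Σ_i (-1)^{Σ_{k<i} e_k} c_i(e_i) x_{e+δ_i},
-- written on coefficient functions: (d f)(e') = Σ_{i, e'_i ≥ 1} ± c_i(e'_i - 1) f(e' - δ_i).
d : ∀ {s} → Vec ℕ s → Cochain s → Cochain s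
d {s} ℓ f e = sumℤ (map (λ i → dterm′ ℓ f e i (lookup e i)) (allFin s))

zeroC : ∀ {s} → Cochain s
zeroC _ = 0ℤ

_⊕C_ : ∀ {s} → Cochain s → Cochain s → Cochain s
(f ⊕C g) e = f e +ℤ g e

⊝C_ : ∀ {s} → Cochain s → Cochain s
(⊝C f) e = - f e

_⊖C_ : ∀ {s} → Cochain s → Cochain s → Cochain s
(f ⊖C g) e = f e -ℤ g e

SuppIn : ∀ {s} → Vec ℕ s → Subset s → Set
SuppIn e T = ∀ i → lookup e i ≢ 0 → i ∈ T

SuppNonempty : ∀ {s} → Vec ℕ s → Set
SuppNonempty e = ∃ λ i → lookup e i ≢ 0

SuppEmpty : ∀ {s} → Vec ℕ s → Set
SuppEmpty e = ∀ i → lookup e i ≡ 0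

suppSize : ∀ {s} → Vec ℕ s → ℕ
suppSize []           = 0
suppSize (zero ∷ es)  = suppSize es
suppSize (suc _ ∷ es) = suc (suppSize es)

-- m_e = gcd { ℓ_i - 1 : i ∈ supp e }   (gcd of the empty set is 0)
mgcd : ∀ {s} → Vec ℕ s → Vec ℕ s → ℕ
mgcd []       []           = 0
mgcd (l ∷ ls) (zero ∷ es)  = mgcd ls es
mgcd (l ∷ ls) (suc _ ∷ es) = gcd (l ∸ 1) (mgcd ls es)

Even2R : ∀ {s} → Vec ℕ s → Set
Even2R e = ∀ i → 2 ∣ℕ lookup e i

-- the basis element in degree k of C_i belongs to the subcomplex C_i^{• j}
-- (C_i^0 if j = 0;  C_i^{j-1} → C_i^j if j > 0)
InTrunc : ℕ → ℕ → Set
InTrunc j k = (j ≡ 0 × k ≡ 0) ⊎ (1 ≤ j × (k ≡ j ⊎ suc k ≡ j))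

-- x_{e'} is a basis element of C_e = ⊗_i C_i^{• e_i}
InBlock : ∀ {s} → Vec ℕ s → Vec ℕ s → Set
InBlock e e' = ∀ i → InTrunc (lookup e i) (lookup e' i)

-- A (sub)complex of C_S, or a quotient complex of it such as C_T,
-- all with the differential d:  eq n  = equality of degree-n cochains,
-- sub n = membership of a cochain in degree n.
record Cx (s : ℕ) : Set₁ where
  field
    eq  : ℕ → Cochain s → Cochain s → Set
    sub : ℕ → Cochain s → Set

eqS : ∀ {s} → ℕ → Cochain s → Cochain s → Set
eqS n f g = ∀ e → deg e ≡ n → f e ≡ g e

CS : ∀ {s} → Cx s
CS = record { eq = eqS ; sub = λ _ _ → ⊤ }

-- C_T (basis e with supp e ⊆ T; its differential is the same formula).
-- The projection C_S → C_T (restriction along P_T ⊆ P_S) is the identity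
-- on coefficient functions, read with this coarser equality.
CT : ∀ {s} → Subset s → Cx s
CT T = record { eq = λ n f g → ∀ e → deg e ≡ n → SuppIn e T → f e ≡ g e
              ; sub = λ _ _ → ⊤ }

Ce : ∀ {s} → Vec ℕ s → Cx s
Ce e = record { eq = eqS
              ; sub = λ n f → ∀ e' → deg e' ≡ n → ¬ InBlock e e' → f e' ≡ 0ℤ }

-- Subquotient groups and isomorphisms.
-- A group given as a subset (Mem) of a carrier with operations, modulo an
-- equivalence _≈_ (the library has no subgroups / quotient groups).

record SubQuot : Set₁ where
  field
    Carrier : Set
    Mem     : Carrier → Set
    _≈_     : Carrier → Carrier → Set
    _∙_     : Carrier → Carrier → Carrier
    0#      : Carrier
    inv     : Carrier → Carrier

open SubQuot

record IsIso (A B : SubQuot) (f : Carrier A → Carrier B) : Set where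
  field
    mem  : ∀ x → Mem A x → Mem B (f x)
    cong : ∀ x y → Mem A x → Mem A y → _≈_ A x y → _≈_ B (f x) (f y)
    hom  : ∀ x y → Mem A x → Mem A y → _≈_ B (f (_∙_ A x y)) (_∙_ B (f x) (f y))
    inj  : ∀ x y → Mem A x → Mem A y → _≈_ B (f x) (f y) → _≈_ A x y
    surj : ∀ y → Mem B y → ∃ λ x → Mem A x × _≈_ B (f x) y

Iso : SubQuot → SubQuot → Set
Iso A B = Σ (Carrier A → Carrier B) (IsIso A B)

Trivial : SubQuot → Set
Trivial A = ∀ x → Mem A x → _≈_ A x (0# A)

CochainGrp : ∀ {s} → Cx s → ℕ → SubQuot
CochainGrp C n = record
  { Carrier = Cochain _ ; Mem = Cx.sub C n ; _≈_ = Cx.eq C n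
  ; _∙_ = _⊕C_ ; 0# = zeroC ; inv = ⊝C_ }

Cob : ∀ {s} → Vec ℕ s → Cx s → ℕ → Cochain s → Set
Cob ℓ C zero    x = Cx.eq C 0 x zeroC
Cob ℓ C (suc n) x = ∃ λ h → Cx.sub C n h × Cx.eq C (suc n) (d ℓ h) x

H : ∀ {s} → Vec ℕ s → Cx s → ℕ → SubQuot
H ℓ C n = record
  { Carrier = Cochain _
  ; Mem = λ f → Cx.sub C n f × Cx.eq C (suc n) (d ℓ f) zeroC
  ; _≈_ = λ f g → Cob ℓ C n (f ⊖C g)
  ; _∙_ = _⊕C_ ; 0# = zeroC ; inv = ⊝C_ }

-- An element is a family with a bound N
-- such that the components of "size" ≥ N vanish (size has finite fibres
-- in all uses, so this is finite support), and components outside P vanish.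
DirectSum : (I : Set) → (I → ℕ) → (I → Set) → (I → SubQuot) → SubQuot
DirectSum I size P G = record
  { Carrier = ℕ × ((i : I) → Carrier (G i))
  ; Mem = λ { (N , g) → (∀ i → Mem (G i) (g i))
                        × (∀ i → N ≤ size i → _≈_ (G i) (g i) (0# (G i)))
                        × (∀ i → ¬ P i → _≈_ (G i) (g i) (0# (G i))) }
  ; _≈_ = λ { (N , g) (M , h) → ∀ i → _≈_ (G i) (g i) (h i) }
  ; _∙_ = λ { (N , g) (M , h) → (N ⊔ M , λ i → _∙_ (G i) (g i) (h i)) }
  ; 0# = (0 , λ i → 0# (G i))
  ; inv = λ { (N , g) → (N , λ i → inv (G i) (g i)) } }

vecsOfDeg : (s n : ℕ) → List (Vec ℕ s)
vecsOfDeg zero zero    = [] ∷ []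
vecsOfDeg zero (suc n) = []
vecsOfDeg (suc s) n    = concatMap (λ k → map (k ∷_) (vecsOfDeg s (n ∸ k))) (upTo (suc n))

CeSum : ∀ {s} → (Vec ℕ s → Set) → ℕ → SubQuot
CeSum P n = DirectSum (Vec ℕ _) deg P (λ e → CochainGrp (Ce e) n)

HeSum : ∀ {s} → Vec ℕ s → (Vec ℕ s → Set) → ℕ → SubQuot
HeSum ℓ P n = DirectSum (Vec ℕ _) deg P (λ e → H ℓ (Ce e) n)

HTotal : ∀ {s} → Vec ℕ s → Vec ℕ s → SubQuot
HTotal ℓ e = DirectSum ℕ (λ n → n) (λ _ → ⊤) (λ n → H ℓ (Ce e) n)

sumMap : ∀ {s} → ℕ × (Vec ℕ s → Cochain s) → Cochain s
sumMap {s} (N , g) e' = sumℤ (map (λ e → g e e') (concatMap (vecsOfDeg s) (upTo N)))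

Zmod : ℕ → ℕ → SubQuot
Zmod m k = record
  { Carrier = Fin k → ℤ ; Mem = λ _ → ⊤
  ; _≈_ = λ x y → ∀ i → (+ m) ∣ℤ (x i -ℤ y i)
  ; _∙_ = λ x y i → x i +ℤ y i ; 0# = λ _ → 0ℤ ; inv = λ x i → - x i }

ZGrp : SubQuot
ZGrp = record { Carrier = ℤ ; Mem = λ _ → ⊤ ; _≈_ = _≡_
              ; _∙_ = _+ℤ_ ; 0# = 0ℤ ; inv = -_ }

{-# OPTIONS --safe #-}
-- Since the differential C_i^j → C_i^{j+1} vanishes for even j, d never moves a basis element x_{e′}
-- out of the block C_e, e = e′ with every coordinate rounded up to an even number; as every x_{e′}
-- lies in exactly one such block, C_S = ⊕_e C_e, and the same holds for C_T with supp e ⊆ T.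
-- If |supp e| = k, then C_e, with its top degree at deg e, is the Koszul complex over ℤ of the
-- k numbers ℓᵢ − 1 (i ∈ supp e). Unimodular changes of basis (Bézout) carry it to the Koszul complex
-- of (m_e, 0, …, 0), i.e. (ℤ –m_e→ ℤ) ⊗ (ℤ –0→ ℤ)^{⊗(k−1)}, whose cohomology is ℤ/m_e on each of the
-- 2^{k−1} basis vectors of the second factor, (k−1 choose j) of them in degree deg e − j.
module Submission where

open import Defs
open import Data.Bool using (Bool; true; false)
open import Data.Empty using (⊥-elim)
open import Data.Fin using (Fin; zero; suc)
import Data.Fin.Properties as FP
open import Data.Fin.Subset using (Subset)
open import Data.Fin.Subset.Properties using (_∈?_)
open import Data.Integer using (ℤ; +_; 0ℤ; 1ℤ; -_)
import Data.Integer.Properties as ℤP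
open import Data.Integer.Tactic.RingSolver using (solve-∀)
open import Data.List using (List; []; _∷_; map; tabulate; allFin; upTo; concatMap; _++_; [_])
import Data.List.Properties as LP
open import Data.Nat as ℕ using (ℕ; zero; suc; _≤_; _<_; z≤n; s≤s; _∸_)
import Data.Nat.Properties as ℕP
open import Data.Nat.Combinatorics using (_C_; nCk+nC[k+1]≡[n+1]C[k+1])
open import Data.Nat.Divisibility using (divides; _∣?_) renaming (_∣_ to _∣ℕ_)
open import Data.Nat.GCD using (gcd; gcd[m,n]∣m; gcd[m,n]∣n; gcd[m,n]≢0; gcd-identityʳ; module Bézout; gcd-GCD)
open import Data.Nat.Primality using (Prime; prime⇒nonTrivial)
open import Data.Product using (Σ; ∃; _×_; _,_; proj₁; proj₂)
open import Data.Sum using (_⊎_; inj₁; inj₂)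
open import Data.Unit using (⊤; tt)
open import Data.Vec as V using (Vec; []; _∷_; lookup; _[_]≔_)
import Data.Vec.Properties as VP
open import Data.Vec.Relation.Binary.Pointwise.Extensional using (ext; Pointwise-≡⇒≡)
open import Data.Vec.Relation.Unary.All using (All; []; _∷_)
open import Function using (_∘_)
open import Relation.Binary.Definitions using (Tri; tri<; tri≈; tri>)
open import Relation.Binary.PropositionalEquality hiding ([_])
open import Relation.Nullary using (¬_; Dec; yes; no)
open import Relation.Nullary.Decidable using (¬?; _→-dec_; _×-dec_)
open import Relation.Unary using (Decidable)

module SubQuotients where
  open SubQuot using (Mem; _≈_; _∙_; 0#)

  ∙-Closed : SubQuot → Set
  ∙-Closed A = ∀ x y → Mem A x → Mem A y → Mem A (_∙_ A x y)

  Iso-∘ : ∀ G₁ G₂ G₃ → ∙-Closed G₁ → ∙-Closed G₂ → (∀ x y z → _≈_ G₃ x y → _≈_ G₃ y z → _≈_ G₃ x z) →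
    Iso G₁ G₂ → Iso G₂ G₃ → Iso G₁ G₃
  Iso-∘ G₁ G₂ G₃ G₁-closed G₂-closed G₃-trans (f , f-iso) (g , g-iso) = g ∘ f , record
    { mem  = λ x x∈ → Ig.mem (f x) (If.mem x x∈)
    ; cong = λ x y x∈ y∈ x≈y → Ig.cong (f x) (f y) (If.mem x x∈) (If.mem y y∈) (If.cong x y x∈ y∈ x≈y)
    ; hom  = λ x y x∈ y∈ → G₃-trans _ _ _
        (Ig.cong _ _ (If.mem _ (G₁-closed x y x∈ y∈)) (G₂-closed _ _ (If.mem x x∈) (If.mem y y∈)) (If.hom x y x∈ y∈))
        (Ig.hom (f x) (f y) (If.mem x x∈) (If.mem y y∈))
    ; inj  = λ x y x∈ y∈ gfx≈gfy → If.inj x y x∈ y∈ (Ig.inj (f x) (f y) (If.mem x x∈) (If.mem y y∈) gfx≈gfy)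
    ; surj = λ z z∈ → via (Ig.surj z z∈)
    }
    where
    module If = IsIso f-iso
    module Ig = IsIso g-iso
    via : ∀ {z} → (∃ λ y → Mem G₂ y × _≈_ G₃ (g y) z) → ∃ λ x → Mem G₁ x × _≈_ G₃ (g (f x)) z
    via (y , y∈ , gy≈z) with If.surj y y∈
    ... | x , x∈ , fx≈y = x , x∈ , G₃-trans _ _ _ (Ig.cong (f x) y (If.mem x x∈) y∈ fx≈y) gy≈z

  DirectSum-∙-closed : ∀ {I} size P G → (∀ i → ∙-Closed (G i)) →
    (∀ i x y → _≈_ (G i) x (0# (G i)) → _≈_ (G i) y (0# (G i)) → _≈_ (G i) (_∙_ (G i) x y) (0# (G i))) →
    ∙-Closed (DirectSum I size P G)
  DirectSum-∙-closed size P G closed null-+ (N , x) (M , y) (x∈ , x-bound , x-P) (y∈ , y-bound , y-P) =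
    (λ i → closed i (x i) (y i) (x∈ i) (y∈ i)) ,
    (λ i N⊔M≤ → null-+ i (x i) (y i) (x-bound i (ℕP.≤-trans (ℕP.m≤m⊔n N M) N⊔M≤))
                                     (y-bound i (ℕP.≤-trans (ℕP.m≤n⊔m N M) N⊔M≤))) ,
    (λ i ¬P → null-+ i (x i) (y i) (x-P i ¬P) (y-P i ¬P))

open SubQuotients

module Differential where
  open import Data.Integer using (_+_; _*_; _-_)

  sgn-+ : ∀ a b → sgn (a ℕ.+ b) ≡ sgn a * sgn b
  sgn-+ zero    b = sym (ℤP.*-identityˡ (sgn b))
  sgn-+ (suc a) b = trans (cong -_ (sgn-+ a b)) (ℤP.neg-distribˡ-* (sgn a) (sgn b))

  sgn-even : ∀ q → sgn (q ℕ.* 2) ≡ 1ℤ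
  sgn-even zero    = refl
  sgn-even (suc q) = trans (ℤP.neg-involutive (sgn (q ℕ.* 2))) (sgn-even q)

  sgn-odd : ∀ q → sgn (suc (q ℕ.* 2)) ≡ - 1ℤ
  sgn-odd q = cong -_ (sgn-even q)

  module _ {A : Set} where
    sumℤ-map-cong : ∀ (F G : A → ℤ) xs → (∀ x → F x ≡ G x) → sumℤ (map F xs) ≡ sumℤ (map G xs)
    sumℤ-map-cong F G xs F≗G = cong sumℤ (LP.map-cong F≗G xs)

    sumℤ-map-zero : ∀ (F : A → ℤ) xs → (∀ x → F x ≡ 0ℤ) → sumℤ (map F xs) ≡ 0ℤ
    sumℤ-map-zero F []       F≗0 = refl
    sumℤ-map-zero F (x ∷ xs) F≗0 rewrite F≗0 x | sumℤ-map-zero F xs F≗0 = refl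

    sumℤ-map-+ : ∀ (F G : A → ℤ) xs → sumℤ (map (λ x → F x + G x) xs) ≡ sumℤ (map F xs) + sumℤ (map G xs)
    sumℤ-map-+ F G []       = refl
    sumℤ-map-+ F G (x ∷ xs) rewrite sumℤ-map-+ F G xs = interchange (F x) (G x) _ _
      where
      interchange : ∀ a b c d → a + b + (c + d) ≡ a + c + (b + d)
      interchange = solve-∀

    sumℤ-map-* : ∀ c (F : A → ℤ) xs → sumℤ (map (λ x → c * F x) xs) ≡ c * sumℤ (map F xs)
    sumℤ-map-* c F []       = sym (ℤP.*-zeroʳ c)
    sumℤ-map-* c F (x ∷ xs) rewrite sumℤ-map-* c F xs = sym (ℤP.*-distribˡ-+ c (F x) _)

    sumℤ-map-neg : ∀ (F : A → ℤ) xs → sumℤ (map (λ x → - F x) xs) ≡ - sumℤ (map F xs)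
    sumℤ-map-neg F []       = refl
    sumℤ-map-neg F (x ∷ xs) rewrite sumℤ-map-neg F xs = sym (ℤP.neg-distrib-+ (F x) _)

  sumℤ-++ : ∀ xs ys → sumℤ (xs ++ ys) ≡ sumℤ xs + sumℤ ys
  sumℤ-++ []       ys = sym (ℤP.+-identityˡ _)
  sumℤ-++ (x ∷ xs) ys rewrite sumℤ-++ xs ys = sym (ℤP.+-assoc x _ _)

  sumℤ-concatMap : ∀ {A B : Set} (F : B → ℤ) (G : A → List B) xs →
    sumℤ (map F (concatMap G xs)) ≡ sumℤ (map (λ x → sumℤ (map F (G x))) xs)
  sumℤ-concatMap F G []       = refl
  sumℤ-concatMap F G (x ∷ xs) = begin
    sumℤ (map F (G x ++ concatMap G xs))                ≡⟨ cong sumℤ (LP.map-++ F (G x) _) ⟩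
    sumℤ (map F (G x) ++ map F (concatMap G xs))        ≡⟨ sumℤ-++ (map F (G x)) _ ⟩
    sumℤ (map F (G x)) + sumℤ (map F (concatMap G xs))  ≡⟨ cong (_+_ (sumℤ (map F (G x)))) (sumℤ-concatMap F G xs) ⟩
    _                                                   ∎
    where open ≡-Reasoning

  module _ {s} (ℓ : Vec ℕ s) where
    d-cong : ∀ f g → (∀ x → f x ≡ g x) → ∀ e → d ℓ f e ≡ d ℓ g e
    d-cong f g f≗g e = sumℤ-map-cong _ _ (allFin s) (λ i → term i (lookup e i))
      where
      term : ∀ i k → dterm′ ℓ f e i k ≡ dterm′ ℓ g e i k
      term i zero    = refl
      term i (suc k) = cong (sgn (prefix e i) * cdiff (lookup ℓ i) k *_) (f≗g _)

    d-zero : ∀ e → d ℓ zeroC e ≡ 0ℤ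
    d-zero e = sumℤ-map-zero _ (allFin s) (λ i → term i (lookup e i))
      where
      term : ∀ i k → dterm′ ℓ zeroC e i k ≡ 0ℤ
      term i zero    = refl
      term i (suc k) = ℤP.*-zeroʳ (sgn (prefix e i) * cdiff (lookup ℓ i) k)

    d-+ : ∀ f g e → d ℓ (f ⊕C g) e ≡ d ℓ f e + d ℓ g e
    d-+ f g e = trans (sumℤ-map-cong _ _ (allFin s) (λ i → term i (lookup e i)))
                      (sumℤ-map-+ (λ i → dterm′ ℓ f e i (lookup e i)) (λ i → dterm′ ℓ g e i (lookup e i)) (allFin s))
      where
      term : ∀ i k → dterm′ ℓ (f ⊕C g) e i k ≡ dterm′ ℓ f e i k + dterm′ ℓ g e i k
      term i zero    = refl
      term i (suc k) = ℤP.*-distribˡ-+ (sgn (prefix e i) * cdiff (lookup ℓ i) k) _ _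

    d-neg : ∀ f e → d ℓ (⊝C f) e ≡ - d ℓ f e
    d-neg f e = trans (sumℤ-map-cong _ _ (allFin s) (λ i → term i (lookup e i)))
                      (sumℤ-map-neg (λ i → dterm′ ℓ f e i (lookup e i)) (allFin s))
      where
      term : ∀ i k → dterm′ ℓ (⊝C f) e i k ≡ - dterm′ ℓ f e i k
      term i zero    = refl
      term i (suc k) = sym (ℤP.neg-distribʳ-* (sgn (prefix e i) * cdiff (lookup ℓ i) k) _)

  dHead : ∀ {s} → ℕ → Cochain (suc s) → ℕ → Vec ℕ s → ℤ
  dHead l f zero    e = 0ℤ
  dHead l f (suc k) e = cdiff l k * f (k ∷ e)

  d-∷ : ∀ {s} l (ℓ : Vec ℕ s) f y e →
    d (l ∷ ℓ) f (y ∷ e) ≡ dHead l f y e + sgn y * d ℓ (λ e′ → f (y ∷ e′)) e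
  d-∷ {s} l ℓ f y e = cong₂ _+_ (head y) tail
    where
    head : ∀ y → dterm′ (l ∷ ℓ) f (y ∷ e) zero y ≡ dHead l f y e
    head zero    = refl
    head (suc k) = cong (_* f (k ∷ e)) (ℤP.*-identityˡ (cdiff l k))
    F : Fin (suc s) → ℤ
    F i = dterm′ (l ∷ ℓ) f (y ∷ e) i (lookup (y ∷ e) i)
    G : Fin s → ℤ
    G i = dterm′ ℓ (λ e′ → f (y ∷ e′)) e i (lookup e i)
    term : ∀ i k → dterm′ (l ∷ ℓ) f (y ∷ e) (suc i) k ≡ sgn y * dterm′ ℓ (λ e′ → f (y ∷ e′)) e i k
    term i zero    = sym (ℤP.*-zeroʳ (sgn y))
    term i (suc k) rewrite sgn-+ y (prefix e i) =
      reassoc (sgn y) (sgn (prefix e i)) (cdiff (lookup ℓ i) k) (f (y ∷ e [ i ]≔ k))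
      where
      reassoc : ∀ a b c x → a * b * c * x ≡ a * (b * c * x)
      reassoc = solve-∀
    tail : sumℤ (map F (tabulate suc)) ≡ sgn y * sumℤ (map G (allFin s))
    tail = begin
      sumℤ (map F (tabulate suc))                ≡⟨ cong sumℤ (LP.map-tabulate suc F) ⟩
      sumℤ (tabulate (F ∘ suc))                  ≡⟨ cong sumℤ (sym (LP.map-tabulate (λ i → i) (F ∘ suc))) ⟩
      sumℤ (map (F ∘ suc) (allFin s))            ≡⟨ sumℤ-map-cong _ _ (allFin s) (λ i → term i (lookup e i)) ⟩
      sumℤ (map (λ i → sgn y * G i) (allFin s))  ≡⟨ sumℤ-map-* (sgn y) G (allFin s) ⟩
      sgn y * sumℤ (map G (allFin s))            ∎
      where open ≡-Reasoning

open Differential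

module Blocks where
  open import Data.Integer using (_*_)

  parity : ∀ k → (∃ λ q → k ≡ q ℕ.* 2) ⊎ (∃ λ q → k ≡ suc (q ℕ.* 2))
  parity zero = inj₁ (0 , refl)
  parity (suc k) with parity k
  ... | inj₁ (q , k≡2q)   = inj₂ (q , cong suc k≡2q)
  ... | inj₂ (q , k≡2q+1) = inj₁ (suc q , cong suc k≡2q+1)

  even≢odd : ∀ q r → q ℕ.* 2 ≢ suc (r ℕ.* 2)
  even≢odd (suc q) (suc r) eq = even≢odd q r (ℕP.suc-injective (ℕP.suc-injective eq))
  even≢odd (suc zero) zero ()
  even≢odd (suc (suc q)) zero ()

  cdiff-even : ∀ l q → cdiff l (q ℕ.* 2) ≡ 0ℤ
  cdiff-even l zero    = refl
  cdiff-even l (suc q) = cdiff-even l q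

  cdiff-odd : ∀ l q → cdiff l (suc (q ℕ.* 2)) ≡ + (l ∸ 1)
  cdiff-odd l zero    = refl
  cdiff-odd l (suc q) = cdiff-odd l q

  -- Degree k of C_i lies in the truncation C_i^{• j} with j = evenCeil k, the least even j ≥ k.
  evenCeil : ℕ → ℕ
  evenCeil zero          = 0
  evenCeil (suc zero)    = 2
  evenCeil (suc (suc k)) = suc (suc (evenCeil k))

  evenCeil-even-form : ∀ q → evenCeil (q ℕ.* 2) ≡ q ℕ.* 2
  evenCeil-even-form zero    = refl
  evenCeil-even-form (suc q) = cong (λ m → suc (suc m)) (evenCeil-even-form q)

  evenCeil-odd-form : ∀ q → evenCeil (suc (q ℕ.* 2)) ≡ suc (suc (q ℕ.* 2))
  evenCeil-odd-form zero    = refl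
  evenCeil-odd-form (suc q) = cong (λ m → suc (suc m)) (evenCeil-odd-form q)

  evenCeil-even : ∀ k → 2 ∣ℕ evenCeil k
  evenCeil-even k with parity k
  ... | inj₁ (q , refl) = divides q (evenCeil-even-form q)
  ... | inj₂ (q , refl) = divides (suc q) (evenCeil-odd-form q)

  evenCeil≡0⇒≡0 : ∀ k → evenCeil k ≡ 0 → k ≡ 0
  evenCeil≡0⇒≡0 zero          _  = refl
  evenCeil≡0⇒≡0 (suc zero)    ()
  evenCeil≡0⇒≡0 (suc (suc k)) ()

  evenCeil≤1+n : ∀ k → evenCeil k ≤ suc k
  evenCeil≤1+n zero          = z≤n
  evenCeil≤1+n (suc zero)    = ℕP.≤-refl
  evenCeil≤1+n (suc (suc k)) = s≤s (s≤s (evenCeil≤1+n k))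

  inTrunc-evenCeil : ∀ k → InTrunc (evenCeil k) k
  inTrunc-evenCeil zero = inj₁ (refl , refl)
  inTrunc-evenCeil (suc k) with parity (suc k)
  ... | inj₁ (suc q , eq) rewrite eq | evenCeil-even-form (suc q) = inj₂ (s≤s z≤n , inj₁ refl)
  ... | inj₂ (q , eq)     rewrite eq | evenCeil-odd-form q        = inj₂ (s≤s z≤n , inj₂ refl)

  inTrunc⇒evenCeil : ∀ j k → 2 ∣ℕ j → InTrunc j k → evenCeil k ≡ j
  inTrunc⇒evenCeil j k _ (inj₁ (refl , refl)) = refl
  inTrunc⇒evenCeil j k (divides q j≡2q) (inj₂ (_ , inj₁ refl)) =
    trans (cong evenCeil j≡2q) (trans (evenCeil-even-form q) (sym j≡2q))
  inTrunc⇒evenCeil j k (divides q j≡2q) (inj₂ (_ , inj₂ refl)) with parity k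
  ... | inj₁ (r , refl) = ⊥-elim (even≢odd q r (sym j≡2q))
  ... | inj₂ (r , refl) = evenCeil-odd-form r

  vec-ext : ∀ {A : Set} {s} (xs ys : Vec A s) → (∀ i → lookup xs i ≡ lookup ys i) → xs ≡ ys
  vec-ext xs ys xs≗ys = Pointwise-≡⇒≡ (ext xs≗ys)

  -- The unique e ∈ 2R with x_{e′} a basis element of C_e.
  block : ∀ {s} → Vec ℕ s → Vec ℕ s
  block = V.map evenCeil

  lookup-block : ∀ {s} (e : Vec ℕ s) i → lookup (block e) i ≡ evenCeil (lookup e i)
  lookup-block e i = VP.lookup-map i evenCeil e

  block-even : ∀ {s} (e : Vec ℕ s) → Even2R (block e)
  block-even e i rewrite lookup-block e i = evenCeil-even (lookup e i)

  inBlock-block : ∀ {s} (e : Vec ℕ s) → InBlock (block e) e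
  inBlock-block e i rewrite lookup-block e i = inTrunc-evenCeil (lookup e i)

  block≡⇒inBlock : ∀ {s} (e e′ : Vec ℕ s) → block e′ ≡ e → InBlock e e′
  block≡⇒inBlock _ e′ refl = inBlock-block e′

  inBlock⇒block≡ : ∀ {s} (e e′ : Vec ℕ s) → Even2R e → InBlock e e′ → block e′ ≡ e
  inBlock⇒block≡ e e′ ev ib = vec-ext _ _ λ i → trans (lookup-block e′ i) (inTrunc⇒evenCeil _ _ (ev i) (ib i))

  suppIn-block⁻ : ∀ {s} (e : Vec ℕ s) T → SuppIn (block e) T → SuppIn e T
  suppIn-block⁻ e T supp⊆T i eᵢ≢0 = supp⊆T i λ blockᵢ≡0 →
    eᵢ≢0 (evenCeil≡0⇒≡0 _ (trans (sym (lookup-block e i)) blockᵢ≡0))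

  suppIn-block : ∀ {s} (e : Vec ℕ s) T → SuppIn e T → SuppIn (block e) T
  suppIn-block e T supp⊆T i blockᵢ≢0 = supp⊆T i λ eᵢ≡0 →
    blockᵢ≢0 (trans (lookup-block e i) (cong evenCeil eᵢ≡0))

  deg-block : ∀ {s} (e : Vec ℕ s) → deg (block e) ≤ deg e ℕ.+ s
  deg-block []            = z≤n
  deg-block {suc s} (x ∷ e) = begin
    evenCeil x ℕ.+ deg (block e) ≤⟨ ℕP.+-mono-≤ (evenCeil≤1+n x) (deg-block e) ⟩
    suc x ℕ.+ (deg e ℕ.+ s)      ≡⟨ cong suc (sym (ℕP.+-assoc x (deg e) s)) ⟩
    suc (x ℕ.+ deg e ℕ.+ s)      ≡⟨ sym (ℕP.+-suc (x ℕ.+ deg e) s) ⟩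
    x ℕ.+ deg e ℕ.+ suc s        ∎
    where open ℕP.≤-Reasoning

  deg-block-bound : ∀ {s} n (e e′ : Vec ℕ s) → deg e′ ≡ n → block e′ ≡ e → ¬ (suc (n ℕ.+ s) ≤ deg e)
  deg-block-bound {s} n _ e′ refl refl = ℕP.<⇒≱ (s≤s (deg-block e′))

  deg-update : ∀ {s} (e : Vec ℕ s) i k → lookup e i ≡ suc k → deg e ≡ suc (deg (e [ i ]≔ k))
  deg-update (x ∷ e) zero    k refl = refl
  deg-update (x ∷ e) (suc i) k eq   = trans (cong (x ℕ.+_) (deg-update e i k eq)) (ℕP.+-suc x _)

  block-update-odd : ∀ {s} (e : Vec ℕ s) i q → lookup e i ≡ suc (suc (q ℕ.* 2)) →
    block (e [ i ]≔ suc (q ℕ.* 2)) ≡ block e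
  block-update-odd e i q eᵢ≡2q+2 = begin
    block (e [ i ]≔ suc (q ℕ.* 2))           ≡⟨ VP.map-[]≔ evenCeil e i ⟩
    block e [ i ]≔ evenCeil (suc (q ℕ.* 2))  ≡⟨ cong (block e [ i ]≔_) same-ceiling ⟩
    block e [ i ]≔ lookup (block e) i        ≡⟨ VP.[]≔-lookup (block e) i ⟩
    block e                                  ∎
    where
    open ≡-Reasoning
    same-ceiling : evenCeil (suc (q ℕ.* 2)) ≡ lookup (block e) i
    same-ceiling = trans (evenCeil-odd-form q)
      (trans (sym (evenCeil-even-form (suc q))) (trans (cong evenCeil (sym eᵢ≡2q+2)) (sym (lookup-block e i))))

  -- d never leaves a block: a term of d at e′ either vanishes (differential 0 out of even degree)
  -- or reads a neighbour of e′ in the same block.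
  d-blockwise : ∀ {s} (ℓ : Vec ℕ s) (F : Vec ℕ s → Cochain s) e →
    d ℓ (λ x → F (block x) x) e ≡ d ℓ (F (block e)) e
  d-blockwise {s} ℓ F e = sumℤ-map-cong _ _ (allFin s) (λ i → term i (lookup e i) refl)
    where
    term : ∀ i k → lookup e i ≡ k → dterm′ ℓ (λ x → F (block x) x) e i k ≡ dterm′ ℓ (F (block e)) e i k
    term i zero    _ = refl
    term i (suc k) eᵢ≡1+k with parity k
    ... | inj₁ (q , refl) rewrite cdiff-even (lookup ℓ i) q | ℤP.*-zeroʳ (sgn (prefix e i)) =
      trans (ℤP.*-zeroˡ (F (block (e [ i ]≔ q ℕ.* 2)) (e [ i ]≔ q ℕ.* 2)))
            (sym (ℤP.*-zeroˡ (F (block e) (e [ i ]≔ q ℕ.* 2))))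
    ... | inj₂ (q , refl) rewrite block-update-odd e i q eᵢ≡1+k = refl

  inBlock-raise : ∀ {s} (e e′ : Vec ℕ s) i q → Even2R e → lookup e′ i ≡ suc (suc (q ℕ.* 2)) →
    InBlock e (e′ [ i ]≔ suc (q ℕ.* 2)) → InBlock e e′
  inBlock-raise e e′ i q ev e′ᵢ≡2q+2 ib j with i FP.≟ j
  ... | no i≢j = subst (InTrunc (lookup e j)) (VP.lookup∘update′ (i≢j ∘ sym) e′ _) (ib j)
  ... | yes refl with ev i | subst (InTrunc (lookup e i)) (VP.lookup∘update i e′ _) (ib i)
  ...   | _            | inj₂ (p , inj₂ eq′) = inj₂ (p , inj₁ (trans e′ᵢ≡2q+2 eq′))
  ...   | divides r eq | inj₂ (_ , inj₁ eq′) = ⊥-elim (even≢odd r q (sym (trans eq′ eq)))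
  ...   | _            | inj₁ (_ , ())

  -- A term of d f at e′ ∉ C_e reads f at e′ lowered by one in some coordinate; from an even degree
  -- that term has coefficient 0, and from an odd one the lowered index is still outside C_e.
  Ce-subcomplex : ∀ {s} (ℓ : Vec ℕ s) e → Even2R e → ∀ n f → Cx.sub (Ce e) n f → Cx.sub (Ce e) (suc n) (d ℓ f)
  Ce-subcomplex {s} ℓ e ev n f f∈Ce e′ deg≡ e′∉Ce = sumℤ-map-zero _ (allFin s) (λ i → term i (lookup e′ i) refl)
    where
    term : ∀ i k → lookup e′ i ≡ k → dterm′ ℓ f e′ i k ≡ 0ℤ
    term i zero    _ = refl
    term i (suc k) e′ᵢ≡1+k with parity k
    ... | inj₁ (q , refl) rewrite cdiff-even (lookup ℓ i) q | ℤP.*-zeroʳ (sgn (prefix e′ i)) =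
      ℤP.*-zeroˡ (f (e′ [ i ]≔ q ℕ.* 2))
    ... | inj₂ (q , refl) rewrite f∈Ce (e′ [ i ]≔ suc (q ℕ.* 2))
                                    (ℕP.suc-injective (trans (sym (deg-update e′ i _ e′ᵢ≡1+k)) deg≡))
                                    (e′∉Ce ∘ inBlock-raise e e′ i q ev e′ᵢ≡1+k) =
      ℤP.*-zeroʳ (sgn (prefix e′ i) * cdiff (lookup ℓ i) (suc (q ℕ.* 2)))

open Blocks

module Decomposition where
  open import Data.Integer using (_+_; _-_)

  keepIf : ∀ {P : Set} → Dec P → ℤ → ℤ
  keepIf (yes _) z = z
  keepIf (no _)  z = 0ℤ

  keepIf-yes : ∀ {P : Set} (P? : Dec P) z → P → keepIf P? z ≡ z
  keepIf-yes (yes _) z _ = refl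
  keepIf-yes (no ¬p) z p = ⊥-elim (¬p p)

  keepIf-no : ∀ {P : Set} (P? : Dec P) z → ¬ P → keepIf P? z ≡ 0ℤ
  keepIf-no (yes p) z ¬p = ⊥-elim (¬p p)
  keepIf-no (no _)  z _  = refl

  keepIf-0 : ∀ {P : Set} (P? : Dec P) → keepIf P? 0ℤ ≡ 0ℤ
  keepIf-0 (yes _) = refl
  keepIf-0 (no _)  = refl

  keepIf-cong : ∀ {P : Set} (P? : Dec P) a b → (P → a ≡ b) → keepIf P? a ≡ keepIf P? b
  keepIf-cong (yes p) a b a≡b = a≡b p
  keepIf-cong (no _)  a b _   = refl

  keepIf-+ : ∀ {P : Set} (P? : Dec P) a b → keepIf P? (a + b) ≡ keepIf P? a + keepIf P? b
  keepIf-+ (yes _) a b = refl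
  keepIf-+ (no _)  a b = refl

  keepIf-minus : ∀ {P : Set} (P? : Dec P) a b → keepIf P? (a - b) ≡ keepIf P? a - keepIf P? b
  keepIf-minus (yes _) a b = refl
  keepIf-minus (no _)  a b = refl

  sumℤ-upTo-single : ∀ M (F : ℕ → ℤ) x → (∀ t → t ≢ x → F t ≡ 0ℤ) →
    sumℤ (map F (upTo M)) ≡ keepIf (x ℕP.<? M) (F x)
  sumℤ-upTo-single zero    F x F≗0 = sym (keepIf-no (x ℕP.<? 0) (F x) ℕP.n≮0)
  sumℤ-upTo-single (suc M) F x F≗0 = begin
    sumℤ (map F (upTo (suc M)))                   ≡⟨ cong (sumℤ ∘ map F) (sym (LP.upTo-∷ʳ M)) ⟩
    sumℤ (map F (upTo M ++ [ M ]))                ≡⟨ cong sumℤ (LP.map-++ F (upTo M) [ M ]) ⟩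
    sumℤ (map F (upTo M) ++ [ F M ])              ≡⟨ sumℤ-++ (map F (upTo M)) [ F M ] ⟩
    sumℤ (map F (upTo M)) + (F M + 0ℤ)            ≡⟨ cong₂ _+_ (sumℤ-upTo-single M F x F≗0) (ℤP.+-identityʳ (F M)) ⟩
    keepIf (x ℕP.<? M) (F x) + F M                ≡⟨ last-step (ℕP.<-cmp x M) ⟩
    keepIf (x ℕP.<? suc M) (F x)                  ∎
    where
    open ≡-Reasoning
    last-step : Tri (x < M) (x ≡ M) (M < x) → keepIf (x ℕP.<? M) (F x) + F M ≡ keepIf (x ℕP.<? suc M) (F x)
    last-step (tri< x<M _ _)
      rewrite keepIf-yes (x ℕP.<? M) (F x) x<M | keepIf-yes (x ℕP.<? suc M) (F x) (ℕP.m<n⇒m<1+n x<M)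
            | F≗0 M (ℕP.<⇒≢ x<M ∘ sym) = ℤP.+-identityʳ (F x)
    last-step (tri≈ _ refl _)
      rewrite keepIf-no (x ℕP.<? x) (F x) (ℕP.n≮n x) | keepIf-yes (x ℕP.<? suc x) (F x) (ℕP.n<1+n x) = ℤP.+-identityˡ (F x)
    last-step (tri> _ _ M<x)
      rewrite keepIf-no (x ℕP.<? M) (F x) (ℕP.<-asym M<x) | keepIf-no (x ℕP.<? suc M) (F x) (ℕP.<⇒≱ M<x ∘ ℕP.≤-pred)
            | F≗0 M (ℕP.<⇒≢ M<x) = refl

  sumℤ-vecsOfDeg-single : ∀ s k (φ : Vec ℕ s → ℤ) e₀ → (∀ e → e ≢ e₀ → φ e ≡ 0ℤ) →
    sumℤ (map φ (vecsOfDeg s k)) ≡ keepIf (deg e₀ ℕP.≟ k) (φ e₀)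
  sumℤ-vecsOfDeg-single zero    zero    φ [] _ = ℤP.+-identityʳ (φ [])
  sumℤ-vecsOfDeg-single zero    (suc k) φ [] _ = refl
  sumℤ-vecsOfDeg-single (suc s) k φ (x ∷ e₀) φ≗0 = begin
    sumℤ (map φ (vecsOfDeg (suc s) k))
      ≡⟨ sumℤ-concatMap φ (λ t → map (t ∷_) (vecsOfDeg s (k ∸ t))) (upTo (suc k)) ⟩
    sumℤ (map (λ t → sumℤ (map φ (map (t ∷_) (vecsOfDeg s (k ∸ t))))) (upTo (suc k)))
      ≡⟨ sumℤ-map-cong _ _ (upTo (suc k)) (λ t → cong sumℤ (sym (LP.map-∘ (vecsOfDeg s (k ∸ t))))) ⟩
    sumℤ (map slice (upTo (suc k)))
      ≡⟨ sumℤ-map-cong _ _ (upTo (suc k)) slice-single ⟩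
    sumℤ (map slice′ (upTo (suc k)))
      ≡⟨ sumℤ-upTo-single (suc k) slice′ x slice′-off ⟩
    keepIf (x ℕP.<? suc k) (slice′ x)
      ≡⟨ head-fits (x ℕ.+ deg e₀ ℕP.≟ k) ⟩
    keepIf (x ℕ.+ deg e₀ ℕP.≟ k) (φ (x ∷ e₀))
      ∎
    where
    open ≡-Reasoning
    slice slice′ : ℕ → ℤ
    slice  t = sumℤ (map (λ e → φ (t ∷ e)) (vecsOfDeg s (k ∸ t)))
    slice′ t = keepIf (deg e₀ ℕP.≟ k ∸ t) (φ (t ∷ e₀))
    slice-single : ∀ t → slice t ≡ slice′ t
    slice-single t = sumℤ-vecsOfDeg-single s (k ∸ t) (λ e → φ (t ∷ e)) e₀
      (λ e e≢e₀ → φ≗0 (t ∷ e) (e≢e₀ ∘ VP.∷-injectiveʳ))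
    slice′-off : ∀ t → t ≢ x → slice′ t ≡ 0ℤ
    slice′-off t t≢x rewrite φ≗0 (t ∷ e₀) (t≢x ∘ VP.∷-injectiveˡ) = keepIf-0 (deg e₀ ℕP.≟ k ∸ t)
    head-fits : (fits : Dec (x ℕ.+ deg e₀ ≡ k)) → keepIf (x ℕP.<? suc k) (slice′ x) ≡ keepIf fits (φ (x ∷ e₀))
    head-fits (yes refl)
      rewrite keepIf-yes (x ℕP.<? suc (x ℕ.+ deg e₀)) (slice′ x) (s≤s (ℕP.m≤m+n x (deg e₀))) =
      keepIf-yes (deg e₀ ℕP.≟ x ℕ.+ deg e₀ ∸ x) _ (sym (ℕP.m+n∸m≡n x (deg e₀)))
    head-fits (no x+deg≢k) with x ℕP.<? suc k
    ... | no _    = refl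
    ... | yes x≤k = keepIf-no (deg e₀ ℕP.≟ k ∸ x) _ λ deg≡ →
      x+deg≢k (trans (cong (x ℕ.+_) deg≡) (ℕP.m+[n∸m]≡n (ℕP.≤-pred x≤k)))

  sumℤ-vecsBelow-single : ∀ {s} N (φ : Vec ℕ s → ℤ) e₀ → (∀ e → e ≢ e₀ → φ e ≡ 0ℤ) →
    sumℤ (map φ (concatMap (vecsOfDeg s) (upTo N))) ≡ keepIf (deg e₀ ℕP.<? N) (φ e₀)
  sumℤ-vecsBelow-single {s} N φ e₀ φ≗0 = begin
    sumℤ (map φ (concatMap (vecsOfDeg s) (upTo N)))
      ≡⟨ sumℤ-concatMap φ (vecsOfDeg s) (upTo N) ⟩
    sumℤ (map (λ k → sumℤ (map φ (vecsOfDeg s k))) (upTo N))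
      ≡⟨ sumℤ-map-cong _ _ (upTo N) (λ k → sumℤ-vecsOfDeg-single s k φ e₀ φ≗0) ⟩
    sumℤ (map (λ k → keepIf (deg e₀ ℕP.≟ k) (φ e₀)) (upTo N))
      ≡⟨ sumℤ-upTo-single N _ (deg e₀) (λ t t≢deg → keepIf-no (deg e₀ ℕP.≟ t) (φ e₀) (t≢deg ∘ sym)) ⟩
    keepIf (deg e₀ ℕP.<? N) (keepIf (deg e₀ ℕP.≟ deg e₀) (φ e₀))
      ≡⟨ cong (keepIf (deg e₀ ℕP.<? N)) (keepIf-yes (deg e₀ ℕP.≟ deg e₀) (φ e₀) refl) ⟩
    keepIf (deg e₀ ℕP.<? N) (φ e₀)
      ∎
    where open ≡-Reasoning

  _≟V_ : ∀ {s} (x y : Vec ℕ s) → Dec (x ≡ y)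
  _≟V_ = VP.≡-dec ℕP._≟_

  Even2R? : ∀ {s} (e : Vec ℕ s) → Dec (Even2R e)
  Even2R? e = FP.all? (λ i → 2 ∣? lookup e i)

  SuppIn? : ∀ {s} (e : Vec ℕ s) T → Dec (SuppIn e T)
  SuppIn? e T = FP.all? (λ i → ¬? (lookup e i ℕP.≟ 0) →-dec (i ∈? T))

  module _ {s} {P : Vec ℕ s → Set} (P? : Decidable P) where
    -- component e f is the C_e-summand of f, dropped unless P e; gate e x is its effect on the entry at x.
    gate : Vec ℕ s → Vec ℕ s → ℤ → ℤ
    gate e x a = keepIf (block x ≟V e) (keepIf (P? e) a)

    component : Vec ℕ s → Cochain s → Cochain s
    component e f x = gate e x (f x)

    gate-off : ∀ e x a → block x ≢ e → gate e x a ≡ 0ℤ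
    gate-off e x a = keepIf-no (block x ≟V e) _

    gate-¬P : ∀ e x a → ¬ P e → gate e x a ≡ 0ℤ
    gate-¬P e x a ¬Pe = trans (cong (keepIf (block x ≟V e)) (keepIf-no (P? e) a ¬Pe)) (keepIf-0 _)

    gate-on : ∀ e x a → block x ≡ e → P e → gate e x a ≡ a
    gate-on e x a block≡e Pe = trans (keepIf-yes (block x ≟V e) _ block≡e) (keepIf-yes (P? e) a Pe)

    gate-cong : ∀ e x a b → (P (block x) → a ≡ b) → gate e x a ≡ gate e x b
    gate-cong e x a b a≡b = keepIf-cong (block x ≟V e) _ _ λ { refl → keepIf-cong (P? e) a b a≡b }

    gate-zero : ∀ e x a → (P (block x) → a ≡ 0ℤ) → gate e x a ≡ 0ℤ
    gate-zero e x a a≡0 = trans (gate-cong e x a 0ℤ a≡0) (trans (cong (keepIf (block x ≟V e)) (keepIf-0 (P? e))) (keepIf-0 _))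

    gate-+ : ∀ e x a b → gate e x (a + b) ≡ gate e x a + gate e x b
    gate-+ e x a b = trans (cong (keepIf (block x ≟V e)) (keepIf-+ (P? e) a b)) (keepIf-+ (block x ≟V e) _ _)

    gate-minus : ∀ e x a b → gate e x (a - b) ≡ gate e x a - gate e x b
    gate-minus e x a b = trans (cong (keepIf (block x ≟V e)) (keepIf-minus (P? e) a b)) (keepIf-minus (block x ≟V e) _ _)

    component-∈Ce : ∀ e f n → Cx.sub (Ce e) n (component e f)
    component-∈Ce e f n e′ _ e′∉Ce = gate-off e e′ (f e′) (e′∉Ce ∘ block≡⇒inBlock e e′)

    d-component : ∀ (ℓ : Vec ℕ s) e f x → d ℓ (component e f) x ≡ gate e x (d ℓ f x)
    d-component ℓ e f x = trans (d-blockwise ℓ (λ b y → keepIf (b ≟V e) (keepIf (P? e) (f y))) x)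
                                (pull-out (block x ≟V e) (P? e))
      where
      pull-out : ∀ {A B : Set} (A? : Dec A) (B? : Dec B) →
        d ℓ (λ y → keepIf A? (keepIf B? (f y))) x ≡ keepIf A? (keepIf B? (d ℓ f x))
      pull-out (yes _) (yes _) = refl
      pull-out (yes _) (no _)  = d-zero ℓ x
      pull-out (no _)  _       = d-zero ℓ x

open Decomposition

module DirectSum where
  open import Data.Integer using (_+_)
  open SubQuot using (Mem)

  -- C_S^n, or C_T^n when Q = (supp ⊆ T): degree-n cochains compared on the basis elements satisfying Q
  Restricted : ∀ {s} → (Vec ℕ s → Set) → ℕ → SubQuot
  Restricted Q n = record
    { Carrier = Cochain _ ; Mem = λ _ → ⊤ ; _≈_ = λ f g → ∀ e → deg e ≡ n → Q e → f e ≡ g e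
    ; _∙_ = _⊕C_ ; 0# = zeroC ; inv = ⊝C_ }

  module _ {s} {P : Vec ℕ s → Set} (P? : Decidable P) (P⇒even : ∀ e → P e → Even2R e) (n : ℕ) where

    CeSum-∙-closed : ∀ x y → Mem (CeSum P n) x → Mem (CeSum P n) y → Mem (CeSum P n) (SubQuot._∙_ (CeSum P n) x y)
    CeSum-∙-closed (N , g) (M , h) (g∈Ce , g-bound , g-P) (h∈Ce , h-bound , h-P) =
      (λ e e′ deg≡ e′∉Ce → cong₂ _+_ (g∈Ce e e′ deg≡ e′∉Ce) (h∈Ce e e′ deg≡ e′∉Ce)) ,
      (λ e N⊔M≤ e′ deg≡ → cong₂ _+_ (g-bound e (ℕP.≤-trans (ℕP.m≤m⊔n N M) N⊔M≤) e′ deg≡)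
                                      (h-bound e (ℕP.≤-trans (ℕP.m≤n⊔m N M) N⊔M≤) e′ deg≡)) ,
      (λ e ¬Pe e′ deg≡ → cong₂ _+_ (g-P e ¬Pe e′ deg≡) (h-P e ¬Pe e′ deg≡))

    off-block-zero : ∀ x → Mem (CeSum P n) x → ∀ e′ → deg e′ ≡ n → ∀ e → e ≢ block e′ → proj₂ x e e′ ≡ 0ℤ
    off-block-zero (_ , g) (g∈Ce , _ , g-P) e′ deg≡ e e≢block with Even2R? e
    ... | yes ev  = g∈Ce e e′ deg≡ (e≢block ∘ sym ∘ inBlock⇒block≡ e e′ ev)
    ... | no ¬ev = g-P e (¬ev ∘ P⇒even e) e′ deg≡

    sumMap-member : ∀ x → Mem (CeSum P n) x → ∀ e′ → deg e′ ≡ n → sumMap x e′ ≡ proj₂ x (block e′) e′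
    sumMap-member x@(N , g) x∈@(_ , g-bound , _) e′ deg≡
      with sumℤ-vecsBelow-single N (λ e → g e e′) (block e′) (off-block-zero x x∈ e′ deg≡)
    ... | sum≡ with deg (block e′) ℕP.<? N
    ...   | yes _ = sum≡
    ...   | no ≮N = trans sum≡ (sym (g-bound (block e′) (ℕP.≮⇒≥ ≮N) e′ deg≡))

    decompose : Cochain s → ℕ × (Vec ℕ s → Cochain s)
    decompose f = suc (n ℕ.+ s) , λ e → component P? e f

    decompose-∈ : ∀ f → Mem (CeSum P n) (decompose f)
    decompose-∈ f =
      (λ e → component-∈Ce P? e f n) ,
      (λ e bound e′ deg≡ → gate-off P? e e′ (f e′) (λ block≡e → deg-block-bound n e e′ deg≡ block≡e bound)) ,
      (λ e ¬Pe e′ _ → gate-¬P P? e e′ (f e′) ¬Pe)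

    sumMap-decompose : ∀ f e′ → deg e′ ≡ n → sumMap (decompose f) e′ ≡ gate P? (block e′) e′ (f e′)
    sumMap-decompose f e′ deg≡ = sumMap-member (decompose f) (decompose-∈ f) e′ deg≡

    isoSumMap : (Q : Vec ℕ s → Set) → (∀ e′ → Q e′ → P (block e′)) → (∀ e′ → P (block e′) → Q e′) →
      IsIso (CeSum P n) (Restricted Q n) sumMap
    isoSumMap Q Q⇒P P⇒Q = record
      { mem  = λ _ _ → tt
      ; cong = λ x y x∈ y∈ x≈y e′ deg≡ _ →
          trans (sumMap-member x x∈ e′ deg≡) (trans (x≈y (block e′) e′ deg≡) (sym (sumMap-member y y∈ e′ deg≡)))
      ; hom  = λ x y x∈ y∈ e′ deg≡ _ →
          trans (sumMap-member _ (CeSum-∙-closed x y x∈ y∈) e′ deg≡)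
                (sym (cong₂ _+_ (sumMap-member x x∈ e′ deg≡) (sumMap-member y y∈ e′ deg≡)))
      ; inj  = inj
      ; surj = λ f _ → decompose f , decompose-∈ f , λ e′ deg≡ Qe′ →
          trans (sumMap-decompose f e′ deg≡) (gate-on P? (block e′) e′ (f e′) refl (Q⇒P e′ Qe′))
      }
      where
      inj : ∀ x y → Mem (CeSum P n) x → Mem (CeSum P n) y →
        SubQuot._≈_ (Restricted Q n) (sumMap x) (sumMap y) → SubQuot._≈_ (CeSum P n) x y
      inj x y x∈ y∈ sums≈ e e′ deg≡ with e ≟V block e′
      ... | no e≢block = trans (off-block-zero x x∈ e′ deg≡ e e≢block) (sym (off-block-zero y y∈ e′ deg≡ e e≢block))
      ... | yes refl with P? (block e′)
      ...   | yes Pe = trans (sym (sumMap-member x x∈ e′ deg≡))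
                             (trans (sums≈ e′ deg≡ (P⇒Q e′ Pe)) (sumMap-member y y∈ e′ deg≡))
      ...   | no ¬Pe = trans (proj₂ (proj₂ x∈) _ ¬Pe e′ deg≡) (sym (proj₂ (proj₂ y∈) _ ¬Pe e′ deg≡))

  isoCS : ∀ s n → IsIso (CeSum {s} Even2R n) (CochainGrp (CS {s}) n) sumMap
  isoCS s n = record
    { mem  = λ _ _ → tt
    ; cong = λ x y x∈ y∈ x≈y e′ deg≡ → IsIso.cong iso x y x∈ y∈ x≈y e′ deg≡ tt
    ; hom  = λ x y x∈ y∈ e′ deg≡ → IsIso.hom iso x y x∈ y∈ e′ deg≡ tt
    ; inj  = λ x y x∈ y∈ sums≈ → IsIso.inj iso x y x∈ y∈ (λ e′ deg≡ _ → sums≈ e′ deg≡)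
    ; surj = λ f _ → let (x , x∈ , sum≈f) = IsIso.surj iso f tt in x , x∈ , λ e′ deg≡ → sum≈f e′ deg≡ tt
    }
    where
    iso = isoSumMap Even2R? (λ _ ev → ev) n (λ _ → ⊤) (λ e′ _ → block-even e′) (λ _ _ → tt)

  SuppInBlock? : ∀ {s} (T : Subset s) → Decidable (λ e → Even2R e × SuppIn e T)
  SuppInBlock? T e = Even2R? e ×-dec SuppIn? e T

  isoCT : ∀ s (T : Subset s) n → IsIso (CeSum (λ e → Even2R e × SuppIn e T) n) (CochainGrp (CT T) n) sumMap
  isoCT s T n = isoSumMap (SuppInBlock? T) (λ _ → proj₁) n (λ e → SuppIn e T)
    (λ e′ supp⊆T → block-even e′ , suppIn-block e′ T supp⊆T) (λ e′ → suppIn-block⁻ e′ T ∘ proj₂)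

  projection-kernel : ∀ s (T : Subset s) n f →
    (Cx.eq (CT T) n f zeroC →
       ∃ λ x → Mem (CeSum (λ e → Even2R e × ¬ SuppIn e T) n) x × eqS n (sumMap x) f)
    × ((∃ λ x → Mem (CeSum (λ e → Even2R e × ¬ SuppIn e T) n) x × eqS n (sumMap x) f) →
       Cx.eq (CT T) n f zeroC)
  projection-kernel s T n f = killed⇒sum , sum⇒killed
    where
    Out : Vec ℕ s → Set
    Out e = Even2R e × ¬ SuppIn e T
    Out? : Decidable Out
    Out? e = Even2R? e ×-dec ¬? (SuppIn? e T)
    SumOfOut : Set
    SumOfOut = ∃ λ x → Mem (CeSum Out n) x × eqS n (sumMap x) f
    own-block : ∀ e′ → (SuppIn e′ T → f e′ ≡ 0ℤ) → Dec (SuppIn (block e′) T) → gate Out? (block e′) e′ (f e′) ≡ f e′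
    own-block e′ _   (no ¬supp) = gate-on Out? (block e′) e′ (f e′) refl (block-even e′ , ¬supp)
    own-block e′ f≈0 (yes supp) = trans (gate-¬P Out? (block e′) e′ (f e′) (λ out → proj₂ out supp))
                                        (sym (f≈0 (suppIn-block⁻ e′ T supp)))
    killed⇒sum : Cx.eq (CT T) n f zeroC → SumOfOut
    killed⇒sum f≈0 = decompose Out? (λ _ → proj₁) n f , decompose-∈ Out? (λ _ → proj₁) n f , λ e′ deg≡ →
      trans (sumMap-decompose Out? (λ _ → proj₁) n f e′ deg≡) (own-block e′ (f≈0 e′ deg≡) (SuppIn? (block e′) T))
    sum⇒killed : SumOfOut → Cx.eq (CT T) n f zeroC
    sum⇒killed (x , x∈ , sum≈f) e′ deg≡ supp⊆T = trans (sym (sum≈f e′ deg≡))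
      (trans (sumMap-member Out? (λ _ → proj₁) n x x∈ e′ deg≡)
             (proj₂ (proj₂ x∈) (block e′) (λ out → proj₂ out (suppIn-block e′ T supp⊆T)) e′ deg≡))

open DirectSum

module CohomologyOfCT where
  open import Data.Integer using (_+_; _-_)
  open SubQuot using (Mem)

  minus-zero : ∀ a → a ≡ 0ℤ → a - 0ℤ ≡ 0ℤ
  minus-zero a refl = refl

  module _ {s} (ℓ : Vec ℕ s) (e : Vec ℕ s) where
    zero-Cob : ∀ n x → eqS n x zeroC → Cob ℓ (Ce e) n x
    zero-Cob zero    x x≈0 = x≈0
    zero-Cob (suc n) x x≈0 = zeroC , (λ _ _ _ → refl) , λ e′ deg≡ → trans (d-zero ℓ e′) (sym (x≈0 e′ deg≡))

    Cob-neg : ∀ n x y → Cob ℓ (Ce e) n x → (∀ e′ → deg e′ ≡ n → y e′ ≡ - x e′) → Cob ℓ (Ce e) n y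
    Cob-neg zero    x y x≈0         y≡-x e′ deg≡ = trans (y≡-x e′ deg≡) (cong -_ (x≈0 e′ deg≡))
    Cob-neg (suc n) x y (h , h∈ , dh≈x) y≡-x =
      ⊝C h , (λ e′ deg≡ e′∉Ce → cong -_ (h∈ e′ deg≡ e′∉Ce)) ,
      λ e′ deg≡ → trans (d-neg ℓ h e′) (trans (cong -_ (dh≈x e′ deg≡)) (sym (y≡-x e′ deg≡)))

  module _ {s} (ℓ : Vec ℕ s) (T : Subset s) where
    private
      P? = SuppInBlock? T
      P = λ (e : Vec ℕ s) → Even2R e × SuppIn e T

    gate-own : ∀ x a → SuppIn x T → gate P? (block x) x a ≡ a
    gate-own x a supp⊆T = gate-on P? (block x) x a refl (block-even x , suppIn-block x T supp⊆T)

    gate-killed : ∀ e x a → (SuppIn x T → a ≡ 0ℤ) → gate P? e x a ≡ 0ℤ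
    gate-killed e x a a≡0 = gate-zero P? e x a (a≡0 ∘ suppIn-block⁻ x T ∘ proj₂)

    toComponents : ℕ → Cochain s → ℕ × (Vec ℕ s → Cochain s)
    toComponents = decompose P? (λ _ → proj₁)

    toComponents-∈ : ∀ n f → Mem (H ℓ (CT T) n) f → Mem (HeSum ℓ P n) (toComponents n f)
    toComponents-∈ n f (_ , df≈0) =
      (λ e → component-∈Ce P? e f n ,
             λ e′ deg≡ → trans (d-component P? ℓ e f e′) (gate-killed e e′ (d ℓ f e′) (df≈0 e′ deg≡))) ,
      (λ e bound → zero-Cob ℓ e n _ λ e′ deg≡ → minus-zero _ (bounded e bound e′ deg≡)) ,
      (λ e ¬Pe → zero-Cob ℓ e n _ λ e′ deg≡ → minus-zero _ (outside e ¬Pe e′ deg≡))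
      where
      open Σ (proj₂ (decompose-∈ P? (λ _ → proj₁) n f)) renaming (proj₁ to bounded; proj₂ to outside)

    toComponents-cong : ∀ n x y → Cob ℓ (CT T) n (x ⊖C y) →
      ∀ e → Cob ℓ (Ce e) n (component P? e x ⊖C component P? e y)
    toComponents-cong zero x y x-y≈0 e e′ deg≡ =
      trans (sym (gate-minus P? e e′ (x e′) (y e′))) (gate-killed e e′ _ (x-y≈0 e′ deg≡))
    toComponents-cong (suc n) x y (h , _ , dh≈x-y) e = component P? e h , component-∈Ce P? e h n , λ e′ deg≡ →
      trans (d-component P? ℓ e h e′)
            (trans (gate-cong P? e e′ _ _ (dh≈x-y e′ deg≡ ∘ suppIn-block⁻ e′ T ∘ proj₂))
                   (gate-minus P? e e′ (x e′) (y e′)))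

    -- Primitives of the components glue to a primitive of x − y, since d acts blockwise.
    glue-Cob : ∀ n x y → (∀ e → Cob ℓ (Ce e) n (component P? e x ⊖C component P? e y)) → Cob ℓ (CT T) n (x ⊖C y)
    glue-Cob zero x y x-y≈0 e′ deg≡ supp⊆T =
      trans (sym (gate-own e′ _ supp⊆T)) (trans (gate-minus P? (block e′) e′ (x e′) (y e′)) (x-y≈0 (block e′) e′ deg≡))
    glue-Cob (suc n) x y x-y≈dh = (λ z → proj₁ (x-y≈dh (block z)) z) , tt , λ e′ deg≡ supp⊆T →
      trans (d-blockwise ℓ (λ b → proj₁ (x-y≈dh b)) e′)
            (trans (proj₂ (proj₂ (x-y≈dh (block e′))) e′ deg≡)
                   (trans (sym (gate-minus P? (block e′) e′ (x e′) (y e′))) (gate-own e′ _ supp⊆T)))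

    toComponents-surj : ∀ n y → Mem (HeSum ℓ P n) y →
      ∃ λ x → Mem (H ℓ (CT T) n) x × SubQuot._≈_ (HeSum ℓ P n) (toComponents n x) y
    toComponents-surj n (_ , G) (G∈ , _ , G-outside) = glued , (tt , glued-cocycle) , λ e → agrees e (P? e)
      where
      glued : Cochain s
      glued z = G (block z) z
      glued-cocycle : ∀ e′ → deg e′ ≡ suc n → SuppIn e′ T → d ℓ glued e′ ≡ 0ℤ
      glued-cocycle e′ deg≡ _ = trans (d-blockwise ℓ G e′) (proj₂ (G∈ (block e′)) e′ deg≡)
      agrees : ∀ e → Dec (P e) → Cob ℓ (Ce e) n (component P? e glued ⊖C G e)
      agrees e (no ¬Pe) = Cob-neg ℓ e n _ _ (G-outside e ¬Pe) λ e′ _ →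
        trans (cong (_- G e e′) (gate-¬P P? e e′ _ ¬Pe)) (0-a≡-[a-0] (G e e′))
        where
        0-a≡-[a-0] : ∀ a → 0ℤ - a ≡ - (a - 0ℤ)
        0-a≡-[a-0] = solve-∀
      agrees e (yes Pe) = zero-Cob ℓ e n _ λ e′ deg≡ → pointwise e′ deg≡ (block e′ ≟V e)
        where
        pointwise : ∀ e′ → deg e′ ≡ n → Dec (block e′ ≡ e) → component P? e glued e′ - G e e′ ≡ 0ℤ
        pointwise e′ _ (yes refl) = trans (cong (_- G e e′) (gate-on P? e e′ _ refl Pe)) (ℤP.+-inverseʳ (G e e′))
        pointwise e′ deg≡ (no block≢e)
          rewrite gate-off P? e e′ (glued e′) block≢e
                | proj₁ (G∈ e) e′ deg≡ (block≢e ∘ inBlock⇒block≡ e e′ (proj₁ Pe)) = refl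

    isoHCT : ∀ n → Iso (H ℓ (CT T) n) (HeSum ℓ P n)
    isoHCT n = toComponents n , record
      { mem  = toComponents-∈ n
      ; cong = λ x y _ _ → toComponents-cong n x y
      ; hom  = λ x y _ _ e → zero-Cob ℓ e n _ λ e′ _ →
          trans (cong (_- (gate P? e e′ (x e′) + gate P? e e′ (y e′))) (gate-+ P? e e′ (x e′) (y e′)))
                (ℤP.+-inverseʳ (gate P? e e′ (x e′) + gate P? e e′ (y e′)))
      ; inj  = λ x y _ _ → glue-Cob n x y
      ; surj = toComponents-surj n
      }

open CohomologyOfCT

module Koszul where
  open import Data.Integer using (_+_; _*_; _-_)

  -- Cochains of the Koszul complex K(a₁,…,a_k) = ⊗ᵢ (ℤ –aᵢ→ ℤ): the basis vector v has a true
  -- at i when its i-th factor sits in the lower of the two degrees.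
  KCochain : ℕ → Set
  KCochain k = Vec Bool k → ℤ

  _⊕K_ _⊖K_ : ∀ {k} → KCochain k → KCochain k → KCochain k
  (x ⊕K y) v = x v + y v
  (x ⊖K y) v = x v - y v

  ⊝K_ : ∀ {k} → KCochain k → KCochain k
  (⊝K x) v = - x v

  zeroK : ∀ {k} → KCochain k
  zeroK _ = 0ℤ

  weight : ∀ {k} → Vec Bool k → ℕ
  weight []          = 0
  weight (true ∷ v)  = suc (weight v)
  weight (false ∷ v) = weight v

  dK : ∀ {k} → Vec ℤ k → KCochain k → KCochain k
  dK []       x []          = 0ℤ
  dK (a ∷ as) x (false ∷ w) = a * x (true ∷ w) + dK as (λ u → x (false ∷ u)) w
  dK (a ∷ as) x (true ∷ w)  = - dK as (λ u → x (true ∷ u)) w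

  -- K(bs) placed so that the basis vector v lives in degree δ ∸ weight v
  eqK : ∀ {k} → ℕ → ℕ → KCochain k → KCochain k → Set
  eqK δ n x y = ∀ v → n ℕ.+ weight v ≡ δ → x v ≡ y v

  CobK : ∀ {k} → Vec ℤ k → ℕ → ℕ → KCochain k → Set
  CobK bs δ zero    x = eqK δ 0 x zeroK
  CobK bs δ (suc n) x = ∃ λ h → eqK δ (suc n) (dK bs h) x

  HK : ∀ {k} → Vec ℤ k → ℕ → ℕ → SubQuot
  HK {k} bs δ n = record
    { Carrier = KCochain k
    ; Mem = λ x → eqK δ (suc n) (dK bs x) zeroK
    ; _≈_ = λ x y → CobK bs δ n (x ⊖K y)
    ; _∙_ = _⊕K_ ; 0# = zeroK ; inv = ⊝K_ }

  HKTotal : ∀ {k} → Vec ℤ k → ℕ → SubQuot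
  HKTotal bs δ = DirectSum ℕ (λ n → n) (λ _ → ⊤) (HK bs δ)

  dK-zero : ∀ {k} (bs : Vec ℤ k) v → dK bs zeroK v ≡ 0ℤ
  dK-zero []       []          = refl
  dK-zero (a ∷ bs) (false ∷ w) rewrite dK-zero bs w = trans (ℤP.+-identityʳ (a * 0ℤ)) (ℤP.*-zeroʳ a)
  dK-zero (a ∷ bs) (true ∷ w)  rewrite dK-zero bs w = refl

  dK-+ : ∀ {k} (bs : Vec ℤ k) x y v → dK bs (x ⊕K y) v ≡ dK bs x v + dK bs y v
  dK-+ []       x y []          = refl
  dK-+ (a ∷ bs) x y (false ∷ w) rewrite dK-+ bs (λ u → x (false ∷ u)) (λ u → y (false ∷ u)) w =
    distrib a (x (true ∷ w)) (y (true ∷ w)) _ _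
    where
    distrib : ∀ a p q r t → a * (p + q) + (r + t) ≡ a * p + r + (a * q + t)
    distrib = solve-∀
  dK-+ (a ∷ bs) x y (true ∷ w)  rewrite dK-+ bs (λ u → x (true ∷ u)) (λ u → y (true ∷ u)) w =
    ℤP.neg-distrib-+ (dK bs (λ u → x (true ∷ u)) w) _

  dK-* : ∀ {k} (bs : Vec ℤ k) c x v → dK bs (λ u → c * x u) v ≡ c * dK bs x v
  dK-* []       c x []          = sym (ℤP.*-zeroʳ c)
  dK-* (a ∷ bs) c x (false ∷ w) rewrite dK-* bs c (λ u → x (false ∷ u)) w = distrib a c (x (true ∷ w)) _
    where
    distrib : ∀ a c p r → a * (c * p) + c * r ≡ c * (a * p + r)
    distrib = solve-∀
  dK-* (a ∷ bs) c x (true ∷ w)  rewrite dK-* bs c (λ u → x (true ∷ u)) w = ℤP.neg-distribʳ-* c _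

  zero-CobK : ∀ {k} (bs : Vec ℤ k) δ n x → eqK δ n x zeroK → CobK bs δ n x
  zero-CobK bs δ zero    x x≈0 = x≈0
  zero-CobK bs δ (suc n) x x≈0 = zeroK , λ v deg≡ → trans (dK-zero bs v) (sym (x≈0 v deg≡))

  CobK-resp : ∀ {k} (bs : Vec ℤ k) δ n x y → CobK bs δ n x → eqK δ n y x → CobK bs δ n y
  CobK-resp bs δ zero    x y x≈0      y≈x v deg≡ = trans (y≈x v deg≡) (x≈0 v deg≡)
  CobK-resp bs δ (suc n) x y (h , dh≈x) y≈x = h , λ v deg≡ → trans (dh≈x v deg≡) (sym (y≈x v deg≡))

  record KoszulIso {k : ℕ} (as bs : Vec ℤ k) : Set where
    field
      to from   : KCochain k → KCochain k
      to-d      : ∀ x v → to (dK as x) v ≡ dK bs (to x) v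
      from-d    : ∀ y v → from (dK bs y) v ≡ dK as (from y) v
      to-from   : ∀ y v → to (from y) v ≡ y v
      from-to   : ∀ x v → from (to x) v ≡ x v
      to-local  : ∀ x x′ v → (∀ u → weight u ≡ weight v → x u ≡ x′ u) → to x v ≡ to x′ v
      from-local : ∀ x x′ v → (∀ u → weight u ≡ weight v → x u ≡ x′ u) → from x v ≡ from x′ v
      to-+      : ∀ x y v → to (x ⊕K y) v ≡ to x v + to y v
      to-*      : ∀ c x v → to (λ u → c * x u) v ≡ c * to x v
      from-+    : ∀ x y v → from (x ⊕K y) v ≡ from x v + from y v
      from-*    : ∀ c x v → from (λ u → c * x u) v ≡ c * from x v

    to-cong : ∀ x x′ → (∀ u → x u ≡ x′ u) → ∀ v → to x v ≡ to x′ v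
    to-cong x x′ x≗x′ v = to-local x x′ v (λ u _ → x≗x′ u)

    from-cong : ∀ x x′ → (∀ u → x u ≡ x′ u) → ∀ v → from x v ≡ from x′ v
    from-cong x x′ x≗x′ v = from-local x x′ v (λ u _ → x≗x′ u)

    to-0 : ∀ v → to zeroK v ≡ 0ℤ
    to-0 v = trans (to-cong zeroK (λ u → 0ℤ * zeroK u) (λ _ → refl) v) (to-* 0ℤ zeroK v)

    from-0 : ∀ v → from zeroK v ≡ 0ℤ
    from-0 v = trans (from-cong zeroK (λ u → 0ℤ * zeroK u) (λ _ → refl) v) (from-* 0ℤ zeroK v)

    to-neg : ∀ x v → to (⊝K x) v ≡ - to x v
    to-neg x v = trans (to-cong _ (λ u → - 1ℤ * x u) (sym ∘ ℤP.-1*i≡-i ∘ x) v)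
                       (trans (to-* (- 1ℤ) x v) (ℤP.-1*i≡-i _))

    from-neg : ∀ x v → from (⊝K x) v ≡ - from x v
    from-neg x v = trans (from-cong _ (λ u → - 1ℤ * x u) (sym ∘ ℤP.-1*i≡-i ∘ x) v)
                         (trans (from-* (- 1ℤ) x v) (ℤP.-1*i≡-i _))

    to-minus : ∀ x y v → to (x ⊖K y) v ≡ to x v - to y v
    to-minus x y v = trans (to-+ x (⊝K y) v) (cong (_+_ (to x v)) (to-neg y v))

    from-minus : ∀ x y v → from (x ⊖K y) v ≡ from x v - from y v
    from-minus x y v = trans (from-+ x (⊝K y) v) (cong (_+_ (from x v)) (from-neg y v))

  koszulIso-id : ∀ {k} (as : Vec ℤ k) → KoszulIso as as
  koszulIso-id as = record
    { to = λ x → x ; from = λ x → x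
    ; to-d = λ _ _ → refl ; from-d = λ _ _ → refl ; to-from = λ _ _ → refl ; from-to = λ _ _ → refl
    ; to-local = λ x x′ v x≈x′ → x≈x′ v refl ; from-local = λ x x′ v x≈x′ → x≈x′ v refl
    ; to-+ = λ _ _ _ → refl ; to-* = λ _ _ _ → refl ; from-+ = λ _ _ _ → refl ; from-* = λ _ _ _ → refl }

  koszulIso-∘ : ∀ {k} {as bs cs : Vec ℤ k} → KoszulIso as bs → KoszulIso bs cs → KoszulIso as cs
  koszulIso-∘ K₁ K₂ = record
    { to = λ x → K₂.to (K₁.to x) ; from = λ y → K₁.from (K₂.from y)
    ; to-d = λ x v → trans (K₂.to-cong _ _ (K₁.to-d x) v) (K₂.to-d (K₁.to x) v)
    ; from-d = λ y v → trans (K₁.from-cong _ _ (K₂.from-d y) v) (K₁.from-d (K₂.from y) v)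
    ; to-from = λ y v → trans (K₂.to-cong _ _ (K₁.to-from (K₂.from y)) v) (K₂.to-from y v)
    ; from-to = λ x v → trans (K₁.from-cong _ _ (K₂.from-to (K₁.to x)) v) (K₁.from-to x v)
    ; to-local = λ x x′ v x≈x′ → K₂.to-local _ _ v λ u wu≡ →
        K₁.to-local x x′ u λ u′ wu′≡ → x≈x′ u′ (trans wu′≡ wu≡)
    ; from-local = λ x x′ v x≈x′ → K₁.from-local _ _ v λ u wu≡ →
        K₂.from-local x x′ u λ u′ wu′≡ → x≈x′ u′ (trans wu′≡ wu≡)
    ; to-+ = λ x y v → trans (K₂.to-cong _ _ (K₁.to-+ x y) v) (K₂.to-+ (K₁.to x) (K₁.to y) v)
    ; to-* = λ c x v → trans (K₂.to-cong _ _ (K₁.to-* c x) v) (K₂.to-* c (K₁.to x) v)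
    ; from-+ = λ x y v → trans (K₁.from-cong _ _ (K₂.from-+ x y) v) (K₁.from-+ (K₂.from x) (K₂.from y) v)
    ; from-* = λ c x v → trans (K₁.from-cong _ _ (K₂.from-* c x) v) (K₁.from-* c (K₂.from x) v) }
    where
    module K₁ = KoszulIso K₁
    module K₂ = KoszulIso K₂

  koszulIso-∷ : ∀ {k} (a : ℤ) {as bs : Vec ℤ k} → KoszulIso as bs → KoszulIso (a ∷ as) (a ∷ bs)
  koszulIso-∷ {k} a {as} {bs} K = record
    { to = to′ ; from = from′
    ; to-d = to-d′ ; from-d = from-d′
    ; to-from = λ { y (b ∷ w) → to-from (λ u → y (b ∷ u)) w }
    ; from-to = λ { x (b ∷ w) → from-to (λ u → x (b ∷ u)) w }
    ; to-local = λ { x x′ (b ∷ w) x≈x′ → to-local _ _ w (λ u wu≡ → x≈x′ (b ∷ u) (weight-∷ b wu≡)) }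
    ; from-local = λ { x x′ (b ∷ w) x≈x′ → from-local _ _ w (λ u wu≡ → x≈x′ (b ∷ u) (weight-∷ b wu≡)) }
    ; to-+ = λ { x y (b ∷ w) → to-+ _ _ w }
    ; to-* = λ { c x (b ∷ w) → to-* c _ w }
    ; from-+ = λ { x y (b ∷ w) → from-+ _ _ w }
    ; from-* = λ { c x (b ∷ w) → from-* c _ w } }
    where
    open KoszulIso K
    to′ from′ : KCochain (suc k) → KCochain (suc k)
    to′   x (b ∷ w) = to (λ u → x (b ∷ u)) w
    from′ y (b ∷ w) = from (λ u → y (b ∷ u)) w
    weight-∷ : ∀ {u w : Vec Bool k} b → weight u ≡ weight w → weight (b ∷ u) ≡ weight (b ∷ w)
    weight-∷ true  = cong suc
    weight-∷ false = λ eq → eq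
    to-d′ : ∀ x v → to′ (dK (a ∷ as) x) v ≡ dK (a ∷ bs) (to′ x) v
    to-d′ x (false ∷ w) = trans (to-+ (λ u → a * x (true ∷ u)) (dK as (λ u → x (false ∷ u))) w)
                                (cong₂ _+_ (to-* a _ w) (to-d _ w))
    to-d′ x (true ∷ w)  = trans (to-neg (dK as (λ u → x (true ∷ u))) w) (cong -_ (to-d _ w))
    from-d′ : ∀ y v → from′ (dK (a ∷ bs) y) v ≡ dK (a ∷ as) (from′ y) v
    from-d′ y (false ∷ w) = trans (from-+ (λ u → a * y (true ∷ u)) (dK bs (λ u → y (false ∷ u))) w)
                                  (cong₂ _+_ (from-* a _ w) (from-d _ w))
    from-d′ y (true ∷ w)  = trans (from-neg (dK bs (λ u → y (true ∷ u))) w) (cong -_ (from-d _ w))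

open Koszul

module KoszulNormalForm where
  open import Data.Integer using (_+_; _*_; _-_)

  dK-lin₂ : ∀ {k} (zs : Vec ℤ k) c₁ X c₂ Y w →
    dK zs (λ u → c₁ * X u + c₂ * Y u) w ≡ c₁ * dK zs X w + c₂ * dK zs Y w
  dK-lin₂ zs c₁ X c₂ Y w =
    trans (dK-+ zs (λ u → c₁ * X u) (λ u → c₂ * Y u) w) (cong₂ _+_ (dK-* zs c₁ X w) (dK-* zs c₂ Y w))

  -- The matrix (p q; r t) acting on the two basis vectors of weight one in the first two factors.
  mix : ∀ {k} → ℤ → ℤ → ℤ → ℤ → KCochain (suc (suc k)) → KCochain (suc (suc k))
  mix p q r t x (true ∷ false ∷ w)  = p * x (true ∷ false ∷ w) + q * x (false ∷ true ∷ w)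
  mix p q r t x (false ∷ true ∷ w)  = r * x (true ∷ false ∷ w) + t * x (false ∷ true ∷ w)
  mix p q r t x (false ∷ false ∷ w) = x (false ∷ false ∷ w)
  mix p q r t x (true ∷ true ∷ w)   = x (true ∷ true ∷ w)

  module _ {k : ℕ} (p q r t : ℤ) where
    mix-local : ∀ (x x′ : KCochain (suc (suc k))) v → (∀ u → weight u ≡ weight v → x u ≡ x′ u) →
      mix p q r t x v ≡ mix p q r t x′ v
    mix-local x x′ (true ∷ false ∷ w)  x≈x′ = cong₂ _+_ (cong (p *_) (x≈x′ _ refl)) (cong (q *_) (x≈x′ _ refl))
    mix-local x x′ (false ∷ true ∷ w)  x≈x′ = cong₂ _+_ (cong (r *_) (x≈x′ _ refl)) (cong (t *_) (x≈x′ _ refl))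
    mix-local x x′ (false ∷ false ∷ w) x≈x′ = x≈x′ _ refl
    mix-local x x′ (true ∷ true ∷ w)   x≈x′ = x≈x′ _ refl

    private
      lin-+ : ∀ c₁ c₂ A B A′ B′ → c₁ * (A + A′) + c₂ * (B + B′) ≡ (c₁ * A + c₂ * B) + (c₁ * A′ + c₂ * B′)
      lin-+ = solve-∀
      lin-* : ∀ c c₁ c₂ A B → c₁ * (c * A) + c₂ * (c * B) ≡ c * (c₁ * A + c₂ * B)
      lin-* = solve-∀

    mix-+ : ∀ (x y : KCochain (suc (suc k))) v → mix p q r t (x ⊕K y) v ≡ mix p q r t x v + mix p q r t y v
    mix-+ x y (true ∷ false ∷ w)  = lin-+ p q _ _ _ _
    mix-+ x y (false ∷ true ∷ w)  = lin-+ r t _ _ _ _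
    mix-+ x y (false ∷ false ∷ w) = refl
    mix-+ x y (true ∷ true ∷ w)   = refl

    mix-* : ∀ c (x : KCochain (suc (suc k))) v → mix p q r t (λ u → c * x u) v ≡ c * mix p q r t x v
    mix-* c x (true ∷ false ∷ w)  = lin-* c p q _ _
    mix-* c x (false ∷ true ∷ w)  = lin-* c r t _ _
    mix-* c x (false ∷ false ∷ w) = refl
    mix-* c x (true ∷ true ∷ w)   = refl

  -- Row operations by a unimodular matrix: K(g p, g q, zs) ≅ K(g, 0, zs) when p t - q r = 1.
  module Euclid {k : ℕ} (g p q r t : ℤ) (det : p * t - q * r ≡ 1ℤ) (zs : Vec ℤ k) where
    as bs : Vec ℤ (suc (suc k))
    as = g * p ∷ g * q ∷ zs
    bs = g ∷ 0ℤ ∷ zs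

    to from : KCochain (suc (suc k)) → KCochain (suc (suc k))
    to   = mix p q r t
    from = mix t (- q) (- r) p

    by-det : ∀ (F : ℤ → ℤ) → F (p * t - q * r) ≡ F 1ℤ
    by-det F = cong F det

    to-from : ∀ y v → to (from y) v ≡ y v
    to-from y (true ∷ false ∷ w)  =
      trans (lhs p q r t _ _) (trans (by-det (λ z → z * y (true ∷ false ∷ w))) (ℤP.*-identityˡ _))
      where
      lhs : ∀ p q r t A B → p * (t * A + - q * B) + q * (- r * A + p * B) ≡ (p * t - q * r) * A
      lhs = solve-∀
    to-from y (false ∷ true ∷ w)  =
      trans (lhs p q r t _ _) (trans (by-det (λ z → z * y (false ∷ true ∷ w))) (ℤP.*-identityˡ _))
      where
      lhs : ∀ p q r t A B → r * (t * A + - q * B) + t * (- r * A + p * B) ≡ (p * t - q * r) * B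
      lhs = solve-∀
    to-from y (false ∷ false ∷ w) = refl
    to-from y (true ∷ true ∷ w)   = refl

    from-to : ∀ x v → from (to x) v ≡ x v
    from-to x (true ∷ false ∷ w)  =
      trans (lhs p q r t _ _) (trans (by-det (λ z → z * x (true ∷ false ∷ w))) (ℤP.*-identityˡ _))
      where
      lhs : ∀ p q r t A B → t * (p * A + q * B) + - q * (r * A + t * B) ≡ (p * t - q * r) * A
      lhs = solve-∀
    from-to x (false ∷ true ∷ w)  =
      trans (lhs p q r t _ _) (trans (by-det (λ z → z * x (false ∷ true ∷ w))) (ℤP.*-identityˡ _))
      where
      lhs : ∀ p q r t A B → - r * (p * A + q * B) + p * (r * A + t * B) ≡ (p * t - q * r) * B
      lhs = solve-∀
    from-to x (false ∷ false ∷ w) = refl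
    from-to x (true ∷ true ∷ w)   = refl

    to-d : ∀ x v → to (dK as x) v ≡ dK bs (to x) v
    to-d x (false ∷ false ∷ w) = lhs g p q r t _ _ _
      where
      lhs : ∀ g p q r t A B C → g * p * A + (g * q * B + C) ≡ g * (p * A + q * B) + (0ℤ * (r * A + t * B) + C)
      lhs = solve-∀
    to-d x (true ∷ false ∷ w)
      rewrite dK-lin₂ zs p (λ u → x (true ∷ false ∷ u)) q (λ u → x (false ∷ true ∷ u)) w = lhs g p q _ _ _
      where
      lhs : ∀ g p q A B C → p * - (g * q * A + B) + q * (g * p * A + - C) ≡ - (0ℤ * A + (p * B + q * C))
      lhs = solve-∀
    to-d x (false ∷ true ∷ w)
      rewrite dK-lin₂ zs r (λ u → x (true ∷ false ∷ u)) t (λ u → x (false ∷ true ∷ u)) w =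
      trans (lhs g p q r t A B C) (trans (by-det (λ z → g * z * A + - (r * B + t * C)))
                                         (cong (λ z → z * A + - (r * B + t * C)) (ℤP.*-identityʳ g)))
      where
      A = x (true ∷ true ∷ w)
      B = dK zs (λ u → x (true ∷ false ∷ u)) w
      C = dK zs (λ u → x (false ∷ true ∷ u)) w
      lhs : ∀ g p q r t A B C → r * - (g * q * A + B) + t * (g * p * A + - C) ≡ g * (p * t - q * r) * A + - (r * B + t * C)
      lhs = solve-∀
    to-d x (true ∷ true ∷ w)   = refl

    from-d : ∀ y v → from (dK bs y) v ≡ dK as (from y) v
    from-d y (false ∷ false ∷ w) =
      sym (trans (lhs g p q r t A B C) (trans (by-det (λ z → g * z * A + C)) (rhs g A B C)))
      where
      A = y (true ∷ false ∷ w)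
      B = y (false ∷ true ∷ w)
      C = dK zs (λ u → y (false ∷ false ∷ u)) w
      lhs : ∀ g p q r t A B C → g * p * (t * A + - q * B) + (g * q * (- r * A + p * B) + C) ≡ g * (p * t - q * r) * A + C
      lhs = solve-∀
      rhs : ∀ g A B C → g * 1ℤ * A + C ≡ g * A + (0ℤ * B + C)
      rhs = solve-∀
    from-d y (true ∷ false ∷ w)
      rewrite dK-lin₂ zs t (λ u → y (true ∷ false ∷ u)) (- q) (λ u → y (false ∷ true ∷ u)) w = lhs g p q t _ _ _
      where
      lhs : ∀ g p q t A B C → t * - (0ℤ * A + B) + - q * (g * A + - C) ≡ - (g * q * A + (t * B + - q * C))
      lhs = solve-∀
    from-d y (false ∷ true ∷ w)
      rewrite dK-lin₂ zs (- r) (λ u → y (true ∷ false ∷ u)) p (λ u → y (false ∷ true ∷ u)) w = lhs g p r _ _ _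
      where
      lhs : ∀ g p r A B C → - r * - (0ℤ * A + B) + p * (g * A + - C) ≡ g * p * A + - (- r * B + p * C)
      lhs = solve-∀
    from-d y (true ∷ true ∷ w)   = refl

    koszulIso-euclid : KoszulIso as bs
    koszulIso-euclid = record
      { to = to ; from = from ; to-d = to-d ; from-d = from-d ; to-from = to-from ; from-to = from-to
      ; to-local = mix-local p q r t ; from-local = mix-local t (- q) (- r) p
      ; to-+ = mix-+ p q r t ; to-* = mix-* p q r t ; from-+ = mix-+ t (- q) (- r) p ; from-* = mix-* t (- q) (- r) p }

  private
    +-cast : ∀ m n p x a → m ℕ.+ n ℕ.* p ≡ x ℕ.* a → + m + + n * + p ≡ + x * + a
    +-cast m n p x a eq =
      trans (sym (trans (ℤP.pos-+ m (n ℕ.* p)) (cong (_+_ (+ m)) (ℤP.pos-* n p)))) (trans (cong +_ eq) (ℤP.pos-* x a))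
    cancel : ∀ u v → u + v - v ≡ u
    cancel = solve-∀
    neg-swap : ∀ x a y b → - x * a - - y * b ≡ y * b - x * a
    neg-swap = solve-∀

  bézout-ℤ : ∀ {g a b} → Bézout.Identity g a b → ∃ λ t → ∃ λ r → t * + a - r * + b ≡ + g
  bézout-ℤ {g} {a} {b} (Bézout.+- x y g+yb≡xa) =
    + x , + y , trans (cong (_- (+ y * + b)) (sym (+-cast g y b x a g+yb≡xa))) (cancel (+ g) (+ y * + b))
  bézout-ℤ {g} {a} {b} (Bézout.-+ x y g+xa≡yb) =
    - + x , - + y , trans (neg-swap (+ x) (+ a) (+ y) (+ b))
                          (trans (cong (_- (+ x * + a)) (sym (+-cast g x a y b g+xa≡yb))) (cancel (+ g) (+ x * + a)))

  koszulIso-gcd₂ : ∀ {k} a b → 1 ≤ a → (zs : Vec ℤ k) → KoszulIso (+ a ∷ + b ∷ zs) (+ gcd a b ∷ 0ℤ ∷ zs)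
  koszulIso-gcd₂ a b a≥1 zs with gcd[m,n]∣m a b | gcd[m,n]∣n a b | bézout-ℤ (Bézout.identity (gcd-GCD a b))
  ... | divides p a≡pg | divides q b≡qg | t , r , ta-rb≡g =
    subst (λ as → KoszulIso as (+ g ∷ 0ℤ ∷ zs)) (cong₂ (λ a′ b′ → a′ ∷ b′ ∷ zs) (sym a≡gp) (sym b≡gq))
          (Euclid.koszulIso-euclid (+ g) (+ p) (+ q) r t det zs)
    where
    g = gcd a b
    instance
      g≢0 : ℕ.NonZero g
      g≢0 = ℕ.≢-nonZero (gcd[m,n]≢0 a b (inj₁ (λ a≡0 → ℕP.<⇒≢ a≥1 (sym a≡0))))
    a≡gp : + a ≡ + g * + p
    a≡gp = trans (cong +_ (trans a≡pg (ℕP.*-comm p g))) (ℤP.pos-* g p)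
    b≡gq : + b ≡ + g * + q
    b≡gq = trans (cong +_ (trans b≡qg (ℕP.*-comm q g))) (ℤP.pos-* g q)
    expand : ∀ g p q r t → g * (p * t - q * r) ≡ t * (g * p) - r * (g * q)
    expand = solve-∀
    det : + p * t - + q * r ≡ 1ℤ
    det = ℤP.*-cancelˡ-≡ (+ g) _ _ (begin
      + g * (+ p * t - + q * r)              ≡⟨ expand (+ g) (+ p) (+ q) r t ⟩
      t * (+ g * + p) - r * (+ g * + q)      ≡⟨ cong₂ (λ a′ b′ → t * a′ - r * b′) (sym a≡gp) (sym b≡gq) ⟩
      t * + a - r * + b                      ≡⟨ ta-rb≡g ⟩
      + g                                    ≡⟨ sym (ℤP.*-identityʳ (+ g)) ⟩
      + g * 1ℤ                               ∎)
      where open ≡-Reasoning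

  gcdModel : ∀ k → ℕ → Vec ℤ k
  gcdModel zero    g = []
  gcdModel (suc r) g = + g ∷ V.replicate r 0ℤ

  gcdAll : ∀ {k} → Vec ℕ k → ℕ
  gcdAll []       = 0
  gcdAll (a ∷ as) = gcd a (gcdAll as)

  koszulIso-gcd : ∀ {k} (as : Vec ℕ k) → All (1 ≤_) as → KoszulIso (V.map +_ as) (gcdModel k (gcdAll as))
  koszulIso-gcd []            _ = koszulIso-id []
  koszulIso-gcd (a ∷ [])      _ =
    subst (λ g → KoszulIso (+ a ∷ []) (+ g ∷ [])) (sym (gcd-identityʳ a)) (koszulIso-id (+ a ∷ []))
  koszulIso-gcd {suc (suc k)} (a ∷ a′ ∷ as) (a≥1 ∷ as≥1) =
    koszulIso-∘ (koszulIso-∷ (+ a) (koszulIso-gcd (a′ ∷ as) as≥1))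
                (koszulIso-gcd₂ a (gcdAll (a′ ∷ as)) a≥1 (V.replicate k 0ℤ))

open KoszulNormalForm

module CeAsKoszul where
  open import Data.Integer using (_+_; _-_)
  open SubQuot using (Mem)

  Cob-resp : ∀ {s} (ℓ e : Vec ℕ s) n x y → Cob ℓ (Ce e) n x → eqS n y x → Cob ℓ (Ce e) n y
  Cob-resp ℓ e zero    x y x≈0             y≈x v deg≡ = trans (y≈x v deg≡) (x≈0 v deg≡)
  Cob-resp ℓ e (suc n) x y (h , h∈Ce , dh≈x) y≈x = h , h∈Ce , λ v deg≡ → trans (dh≈x v deg≡) (sym (y≈x v deg≡))

  -- A chain isomorphism C_e ≅ K(bs), where K(bs) is placed with its top degree at δ.
  record CeKoszulIso {s k : ℕ} (ℓ e : Vec ℕ s) (bs : Vec ℤ k) (δ : ℕ) : Set where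
    field
      to         : Cochain s → KCochain k
      from       : KCochain k → Cochain s
      to-d       : ∀ f v → to (d ℓ f) v ≡ dK bs (to f) v
      from-d     : ∀ g x → from (dK bs g) x ≡ d ℓ (from g) x
      to-from    : ∀ g v → to (from g) v ≡ g v
      from-to    : ∀ n f → Cx.sub (Ce e) n f → eqS n (from (to f)) f
      to-cong    : ∀ n f f′ → eqS n f f′ → eqK δ n (to f) (to f′)
      from-cong  : ∀ n g g′ → eqK δ n g g′ → eqS n (from g) (from g′)
      from-∈Ce   : ∀ n g → Cx.sub (Ce e) n (from g)
      to-+       : ∀ f f′ v → to (f ⊕C f′) v ≡ to f v + to f′ v
      to-minus   : ∀ f f′ v → to (f ⊖C f′) v ≡ to f v - to f′ v
      to-0       : ∀ v → to zeroC v ≡ 0ℤ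
      from-minus : ∀ g g′ x → from (g ⊖K g′) x ≡ from g x - from g′ x
      from-0     : ∀ x → from zeroK x ≡ 0ℤ
      from-ext   : ∀ g g′ → (∀ v → g v ≡ g′ v) → ∀ x → from g x ≡ from g′ x

    to-Cob : ∀ n x → Cob ℓ (Ce e) n x → CobK bs δ n (to x)
    to-Cob zero    x x≈0              v deg≡ = trans (to-cong 0 x zeroC x≈0 v deg≡) (to-0 v)
    to-Cob (suc n) x (h , _ , dh≈x) = to h , λ v deg≡ → trans (sym (to-d h v)) (to-cong (suc n) _ _ dh≈x v deg≡)

    from-Cob : ∀ n y → CobK bs δ n y → Cob ℓ (Ce e) n (from y)
    from-Cob zero    y y≈0        x deg≡ = trans (from-cong 0 y zeroK y≈0 x deg≡) (from-0 x)
    from-Cob (suc n) y (h , dh≈y) = from h , from-∈Ce n h , λ x deg≡ →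
      trans (sym (from-d h x)) (from-cong (suc n) _ _ dh≈y x deg≡)

    to-∈ : ∀ n f → Mem (H ℓ (Ce e) n) f → Mem (HK bs δ n) (to f)
    to-∈ n f (_ , df≈0) v deg≡ = trans (sym (to-d f v)) (trans (to-cong (suc n) (d ℓ f) zeroC df≈0 v deg≡) (to-0 v))

    from-∈ : ∀ n y → Mem (HK bs δ n) y → Mem (H ℓ (Ce e) n) (from y)
    from-∈ n y dy≈0 = from-∈Ce n y , λ x deg≡ →
      trans (sym (from-d y x)) (trans (from-cong (suc n) _ _ dy≈0 x deg≡) (from-0 x))

    to-resp-≈ : ∀ n f f′ → Cob ℓ (Ce e) n (f ⊖C f′) → CobK bs δ n (to f ⊖K to f′)
    to-resp-≈ n f f′ f≈f′ = CobK-resp bs δ n _ _ (to-Cob n _ f≈f′) (λ v _ → sym (to-minus f f′ v))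

    to-hom : ∀ n f f′ → CobK bs δ n (to (f ⊕C f′) ⊖K (to f ⊕K to f′))
    to-hom n f f′ = zero-CobK bs δ n _ λ v _ →
      trans (cong (_- (to f v + to f′ v)) (to-+ f f′ v)) (ℤP.+-inverseʳ (to f v + to f′ v))

    to-reflects-≈ : ∀ n f f′ → Cx.sub (Ce e) n f → Cx.sub (Ce e) n f′ →
      CobK bs δ n (to f ⊖K to f′) → Cob ℓ (Ce e) n (f ⊖C f′)
    to-reflects-≈ n f f′ f∈Ce f′∈Ce tf≈tf′ = Cob-resp ℓ e n _ _ (from-Cob n _ tf≈tf′) λ x deg≡ →
      sym (trans (from-minus (to f) (to f′) x) (cong₂ _-_ (from-to n f f∈Ce x deg≡) (from-to n f′ f′∈Ce x deg≡)))

    to-from-≈ : ∀ n y → CobK bs δ n (to (from y) ⊖K y)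
    to-from-≈ n y = zero-CobK bs δ n _ λ v _ → trans (cong (_- y v) (to-from y v)) (ℤP.+-inverseʳ (y v))

    isoH : ∀ n → Iso (H ℓ (Ce e) n) (HK bs δ n)
    isoH n = to , record
      { mem  = to-∈ n
      ; cong = λ f f′ _ _ → to-resp-≈ n f f′
      ; hom  = λ f f′ _ _ → to-hom n f f′
      ; inj  = λ f f′ f∈ f′∈ → to-reflects-≈ n f f′ (proj₁ f∈) (proj₁ f′∈)
      ; surj = λ y y∈ → from y , from-∈ n y y∈ , to-from-≈ n y
      }

    isoTotal : Iso (HTotal ℓ e) (HKTotal bs δ)
    isoTotal = (λ { (N , G) → N , λ n → to (G n) }) , record
      { mem  = λ { (N , G) (G∈ , G-bound , _) →
                 (λ n → to-∈ n (G n) (G∈ n)) ,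
                 (λ n bound → CobK-resp bs δ n _ _ (to-Cob n _ (G-bound n bound)) λ v _ →
                    trans (cong (_-_ (to (G n) v)) (sym (to-0 v))) (sym (to-minus (G n) zeroC v))) ,
                 (λ n ¬tt → ⊥-elim (¬tt tt)) }
      ; cong = λ { (N , G) (M , G′) _ _ G≈G′ n → to-resp-≈ n (G n) (G′ n) (G≈G′ n) }
      ; hom  = λ { (N , G) (M , G′) _ _ n → to-hom n (G n) (G′ n) }
      ; inj  = λ { (N , G) (M , G′) (G∈ , _) (G′∈ , _) tG≈tG′ n →
                 to-reflects-≈ n (G n) (G′ n) (proj₁ (G∈ n)) (proj₁ (G′∈ n)) (tG≈tG′ n) }
      ; surj = λ { (N , Y) (Y∈ , Y-bound , _) →
                 (N , λ n → from (Y n)) ,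
                 ((λ n → from-∈ n (Y n) (Y∈ n)) ,
                  (λ n bound → Cob-resp ℓ e n _ _ (from-Cob n _ (Y-bound n bound)) λ x _ →
                     trans (cong (_-_ (from (Y n) x)) (sym (from-0 x))) (sym (from-minus (Y n) zeroK x))) ,
                  (λ n ¬tt → ⊥-elim (¬tt tt))) ,
                 (λ n → to-from-≈ n (Y n)) }
      }

    trivial : ∀ n → Trivial (HK bs δ n) → Trivial (H ℓ (Ce e) n)
    trivial n HK-trivial f f∈@(f∈Ce , _) = Cob-resp ℓ e n _ _ (from-Cob n _ (HK-trivial (to f) (to-∈ n f f∈))) λ x deg≡ →
      sym (trans (from-minus (to f) zeroK x) (cong₂ _-_ (from-to n f f∈Ce x deg≡) (from-0 x)))

  ceKoszulIso-∘ : ∀ {s k} {ℓ e : Vec ℕ s} {as bs : Vec ℤ k} {δ} →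
    CeKoszulIso ℓ e as δ → KoszulIso as bs → CeKoszulIso ℓ e bs δ
  ceKoszulIso-∘ {ℓ = ℓ} {e} {as} {bs} {δ} C K = record
    { to         = λ f → K.to (C.to f)
    ; from       = λ g → C.from (K.from g)
    ; to-d       = λ f v → trans (K.to-cong _ _ (C.to-d f) v) (K.to-d (C.to f) v)
    ; from-d     = λ g x → trans (C.from-ext _ _ (K.from-d g) x) (C.from-d (K.from g) x)
    ; to-from    = λ g v → trans (K.to-cong _ _ (C.to-from (K.from g)) v) (K.to-from g v)
    ; from-to    = λ n f f∈Ce x deg≡ → trans (C.from-ext _ _ (K.from-to (C.to f)) x) (C.from-to n f f∈Ce x deg≡)
    ; to-cong    = λ n f f′ f≈f′ v deg≡ → K.to-local _ _ v λ u wu≡ →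
                    C.to-cong n f f′ f≈f′ u (trans (cong (n ℕ.+_) wu≡) deg≡)
    ; from-cong  = λ n g g′ g≈g′ x deg≡ → C.from-cong n _ _ (λ u deg≡′ → K.from-local g g′ u
                    (λ u′ wu′≡ → g≈g′ u′ (trans (cong (n ℕ.+_) wu′≡) deg≡′))) x deg≡
    ; from-∈Ce   = λ n g → C.from-∈Ce n (K.from g)
    ; to-+       = λ f f′ v → trans (K.to-cong _ _ (C.to-+ f f′) v) (K.to-+ (C.to f) (C.to f′) v)
    ; to-minus   = λ f f′ v → trans (K.to-cong _ _ (C.to-minus f f′) v) (K.to-minus (C.to f) (C.to f′) v)
    ; to-0       = λ v → trans (K.to-cong _ _ C.to-0 v) (K.to-0 v)
    ; from-minus = λ g g′ x → trans (C.from-ext _ _ (K.from-minus g g′) x) (C.from-minus (K.from g) (K.from g′) x)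
    ; from-0     = λ x → trans (C.from-ext _ _ K.from-0 x) (C.from-0 x)
    ; from-ext   = λ g g′ g≗g′ x → C.from-ext _ _ (K.from-cong g g′ g≗g′) x }
    where
    module C = CeKoszulIso C
    module K = KoszulIso K

open CeAsKoszul

module CeKoszulBasis where
  suppCoeffs : ∀ {s} → Vec ℕ s → (e : Vec ℕ s) → Vec ℕ (suppSize e)
  suppCoeffs []      []          = []
  suppCoeffs (l ∷ ℓ) (zero ∷ e)  = suppCoeffs ℓ e
  suppCoeffs (l ∷ ℓ) (suc _ ∷ e) = (l ∸ 1) ∷ suppCoeffs ℓ e

  -- The basis element of C_e indexed by v: at the i-th point of supp e it sits in degree e_i − 1
  -- if vᵢ is true and in degree e_i otherwise.
  embed : ∀ {s} (e : Vec ℕ s) → Vec Bool (suppSize e) → Vec ℕ s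
  embed []          []          = []
  embed (zero ∷ e)  v           = 0 ∷ embed e v
  embed (suc x ∷ e) (false ∷ v) = suc x ∷ embed e v
  embed (suc x ∷ e) (true ∷ v)  = x ∷ embed e v

  choose : ∀ {P Q : Set} → Dec P → Dec Q → ℤ → ℤ → ℤ
  choose (yes _) _       a b = a
  choose (no _)  (yes _) a b = b
  choose (no _)  (no _)  a b = 0ℤ

  choose-first : ∀ {P Q : Set} (P? : Dec P) (Q? : Dec Q) a b → P → choose P? Q? a b ≡ a
  choose-first (yes _) _ a b _ = refl
  choose-first (no ¬p) _ a b p = ⊥-elim (¬p p)

  choose-second : ∀ {P Q : Set} (P? : Dec P) (Q? : Dec Q) a b → ¬ P → Q → choose P? Q? a b ≡ b
  choose-second (yes p) _       a b ¬p _ = ⊥-elim (¬p p)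
  choose-second (no _)  (yes _) a b _  _ = refl
  choose-second (no _)  (no ¬q) a b _  q = ⊥-elim (¬q q)

  choose-neither : ∀ {P Q : Set} (P? : Dec P) (Q? : Dec Q) a b → ¬ P → ¬ Q → choose P? Q? a b ≡ 0ℤ
  choose-neither (yes p) _       a b ¬p _  = ⊥-elim (¬p p)
  choose-neither (no _)  (yes q) a b _  ¬q = ⊥-elim (¬q q)
  choose-neither (no _)  (no _)  a b _  _  = refl

  extendByZero : ∀ {s} (e : Vec ℕ s) → KCochain (suppSize e) → Cochain s
  extendByZero []          g []           = g []
  extendByZero (zero ∷ e)  g (zero ∷ x)   = extendByZero e g x
  extendByZero (zero ∷ e)  g (suc _ ∷ x)  = 0ℤ
  extendByZero (suc k ∷ e) g (y ∷ x)      =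
    choose (y ℕP.≟ suc k) (y ℕP.≟ k) (extendByZero e (λ w → g (false ∷ w)) x) (extendByZero e (λ w → g (true ∷ w)) x)

  inBlock-∷ : ∀ {s} {j k} {e e′ : Vec ℕ s} → InTrunc j k → InBlock e e′ → InBlock (j ∷ e) (k ∷ e′)
  inBlock-∷ jk _   zero    = jk
  inBlock-∷ _  ee′ (suc i) = ee′ i

  extendByZero-embed : ∀ {s} (e : Vec ℕ s) g v → extendByZero e g (embed e v) ≡ g v
  extendByZero-embed []          g []          = refl
  extendByZero-embed (zero ∷ e)  g v           = extendByZero-embed e g v
  extendByZero-embed (suc x ∷ e) g (false ∷ w) =
    trans (choose-first (suc x ℕP.≟ suc x) (suc x ℕP.≟ x) _ _ refl) (extendByZero-embed e (λ u → g (false ∷ u)) w)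
  extendByZero-embed (suc x ∷ e) g (true ∷ w)  =
    trans (choose-second (x ℕP.≟ suc x) (x ℕP.≟ x) _ _ (ℕP.1+n≢n ∘ sym) refl) (extendByZero-embed e (λ u → g (true ∷ u)) w)

  extendByZero-cases : ∀ {s} (e x : Vec ℕ s) →
    (¬ InBlock e x × (∀ g → extendByZero e g x ≡ 0ℤ)) ⊎ (∃ λ v → embed e v ≡ x × (∀ g → extendByZero e g x ≡ g v))
  extendByZero-cases []          []          = inj₂ ([] , refl , λ _ → refl)
  extendByZero-cases (zero ∷ e)  (zero ∷ x) with extendByZero-cases e x
  ... | inj₁ (x∉Ce , zero-there) = inj₁ (x∉Ce ∘ (_∘ suc) , zero-there)
  ... | inj₂ (v , refl , value)  = inj₂ (v , refl , value)
  extendByZero-cases (zero ∷ e)  (suc y ∷ x) = inj₁ ((λ x∈Ce → not-in-C⁰ (x∈Ce zero)) , λ _ → refl)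
    where
    not-in-C⁰ : ¬ InTrunc 0 (suc y)
    not-in-C⁰ (inj₁ (_ , ()))
    not-in-C⁰ (inj₂ (() , _))
  extendByZero-cases (suc k ∷ e) (y ∷ x) with y ℕP.≟ suc k | y ℕP.≟ k | extendByZero-cases e x
  ... | yes refl | _        | inj₁ (x∉Ce , zero-there) = inj₁ (x∉Ce ∘ (_∘ suc) , λ g → zero-there _)
  ... | yes refl | _        | inj₂ (v , refl , value)  = inj₂ (false ∷ v , refl , λ g → value _)
  ... | no _     | yes refl | inj₁ (x∉Ce , zero-there) = inj₁ (x∉Ce ∘ (_∘ suc) , λ g → zero-there _)
  ... | no _     | yes refl | inj₂ (v , refl , value)  = inj₂ (true ∷ v , refl , λ g → value _)
  ... | no y≢k+1 | no y≢k   | _                        = inj₁ ((λ x∈Ce → not-in-Cᵏ (x∈Ce zero)) , λ _ → refl)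
    where
    not-in-Cᵏ : ¬ InTrunc (suc k) y
    not-in-Cᵏ (inj₁ (() , _))
    not-in-Cᵏ (inj₂ (_ , inj₁ y≡k+1)) = y≢k+1 y≡k+1
    not-in-Cᵏ (inj₂ (_ , inj₂ y+1≡k+1)) = y≢k (ℕP.suc-injective y+1≡k+1)

  deg-embed : ∀ {s} (e : Vec ℕ s) v → deg (embed e v) ℕ.+ weight v ≡ deg e
  deg-embed []          []          = refl
  deg-embed (zero ∷ e)  v           = deg-embed e v
  deg-embed (suc x ∷ e) (false ∷ w) =
    trans (ℕP.+-assoc (suc x) (deg (embed e w)) (weight w)) (cong (suc x ℕ.+_) (deg-embed e w))
  deg-embed (suc x ∷ e) (true ∷ w)  = begin
    x ℕ.+ deg (embed e w) ℕ.+ suc (weight w)   ≡⟨ ℕP.+-assoc x _ _ ⟩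
    x ℕ.+ (deg (embed e w) ℕ.+ suc (weight w)) ≡⟨ cong (x ℕ.+_) (ℕP.+-suc (deg (embed e w)) (weight w)) ⟩
    x ℕ.+ suc (deg (embed e w) ℕ.+ weight w)   ≡⟨ ℕP.+-suc x _ ⟩
    suc (x ℕ.+ (deg (embed e w) ℕ.+ weight w)) ≡⟨ cong (λ m → suc (x ℕ.+ m)) (deg-embed e w) ⟩
    suc (x ℕ.+ deg e)                          ∎
    where open ≡-Reasoning

  inBlock-embed : ∀ {s} (e : Vec ℕ s) v → InBlock e (embed e v)
  inBlock-embed []          []          ()
  inBlock-embed (zero ∷ e)  v           = inBlock-∷ (inj₁ (refl , refl)) (inBlock-embed e v)
  inBlock-embed (suc x ∷ e) (false ∷ w) = inBlock-∷ (inj₂ (s≤s z≤n , inj₁ refl)) (inBlock-embed e w)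
  inBlock-embed (suc x ∷ e) (true ∷ w)  = inBlock-∷ (inj₂ (s≤s z≤n , inj₂ refl)) (inBlock-embed e w)

  module _ {s} (e : Vec ℕ s) where
    extendByZero-∈Ce : ∀ n g → Cx.sub (Ce e) n (extendByZero e g)
    extendByZero-∈Ce n g x _ x∉Ce with extendByZero-cases e x
    ... | inj₁ (_ , zero-there)   = zero-there g
    ... | inj₂ (v , refl , value) = ⊥-elim (x∉Ce (inBlock-embed e v))

    extendByZero-local : ∀ g g′ x → (∀ v → embed e v ≡ x → g v ≡ g′ v) → extendByZero e g x ≡ extendByZero e g′ x
    extendByZero-local g g′ x g≈g′ with extendByZero-cases e x
    ... | inj₁ (_ , zero-there)   = trans (zero-there g) (sym (zero-there g′))
    ... | inj₂ (v , v↦x , value)  = trans (value g) (trans (g≈g′ v v↦x) (sym (value g′)))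

    extendByZero-pointwise : ∀ (F : ℤ → ℤ → ℤ) → F 0ℤ 0ℤ ≡ 0ℤ → ∀ g g′ x →
      extendByZero e (λ v → F (g v) (g′ v)) x ≡ F (extendByZero e g x) (extendByZero e g′ x)
    extendByZero-pointwise F F00 g g′ x with extendByZero-cases e x
    ... | inj₁ (_ , zero-there)  rewrite zero-there (λ v → F (g v) (g′ v)) | zero-there g | zero-there g′ = sym F00
    ... | inj₂ (v , _ , value)   rewrite value (λ v → F (g v) (g′ v)) | value g | value g′ = refl

open CeKoszulBasis

module CeKoszulDifferential where
  open import Data.Integer using (_+_; _*_; _-_)

  suppCoeffsℤ : ∀ {s} → Vec ℕ s → (e : Vec ℕ s) → Vec ℤ (suppSize e)
  suppCoeffsℤ ℓ e = V.map +_ (suppCoeffs ℓ e)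

  even-pred-odd : ∀ x → 2 ∣ℕ suc x → ∃ λ q → x ≡ suc (q ℕ.* 2)
  even-pred-odd x (divides (suc q) 1+x≡2q+2) = q , ℕP.suc-injective 1+x≡2q+2

  0+1*a≡a : ∀ a → 0ℤ + 1ℤ * a ≡ a
  0+1*a≡a a = trans (ℤP.+-identityˡ _) (ℤP.*-identityˡ a)

  d-embed : ∀ {s} (ℓ e : Vec ℕ s) → Even2R e → ∀ f v → d ℓ f (embed e v) ≡ dK (suppCoeffsℤ ℓ e) (λ u → f (embed e u)) v
  d-embed []      []          _  f [] = refl
  d-embed (l ∷ ℓ) (zero ∷ e)  ev f v  =
    trans (d-∷ l ℓ f 0 (embed e v)) (trans (0+1*a≡a _) (d-embed ℓ e (ev ∘ suc) (λ x → f (0 ∷ x)) v))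
  d-embed (l ∷ ℓ) (suc x ∷ e) ev f (b ∷ w) with even-pred-odd x (ev zero)
  ... | q , refl = head b
    where
    IH = d-embed ℓ e (ev ∘ suc)
    head : ∀ b → d (l ∷ ℓ) f (embed (suc x ∷ e) (b ∷ w))
               ≡ dK (suppCoeffsℤ (l ∷ ℓ) (suc x ∷ e)) (λ u → f (embed (suc x ∷ e) u)) (b ∷ w)
    head false = begin
      d (l ∷ ℓ) f (suc x ∷ embed e w)
        ≡⟨ d-∷ l ℓ f (suc x) (embed e w) ⟩
      cdiff l x * f (x ∷ embed e w) + sgn (suc x) * d ℓ (λ y → f (suc x ∷ y)) (embed e w)
        ≡⟨ cong₂ (λ c σ → c * f (x ∷ embed e w) + σ * d ℓ (λ y → f (suc x ∷ y)) (embed e w))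
                 (cdiff-odd l q) (sgn-even (suc q)) ⟩
      + (l ∸ 1) * f (x ∷ embed e w) + 1ℤ * d ℓ (λ y → f (suc x ∷ y)) (embed e w)
        ≡⟨ cong (_+_ (+ (l ∸ 1) * f (x ∷ embed e w))) (trans (ℤP.*-identityˡ _) (IH (λ y → f (suc x ∷ y)) w)) ⟩
      + (l ∸ 1) * f (x ∷ embed e w) + dK (suppCoeffsℤ ℓ e) (λ u → f (suc x ∷ embed e u)) w
        ∎
      where open ≡-Reasoning
    head true = begin
      d (l ∷ ℓ) f (x ∷ embed e w)
        ≡⟨ d-∷ l ℓ f x (embed e w) ⟩
      cdiff l (q ℕ.* 2) * f (q ℕ.* 2 ∷ embed e w) + sgn x * d ℓ (λ y → f (x ∷ y)) (embed e w)
        ≡⟨ cong₂ (λ c σ → c * f (q ℕ.* 2 ∷ embed e w) + σ * d ℓ (λ y → f (x ∷ y)) (embed e w))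
                 (cdiff-even l q) (sgn-odd q) ⟩
      0ℤ + - 1ℤ * d ℓ (λ y → f (x ∷ y)) (embed e w)
        ≡⟨ trans (ℤP.+-identityˡ _) (ℤP.-1*i≡-i _) ⟩
      - d ℓ (λ y → f (x ∷ y)) (embed e w)
        ≡⟨ cong -_ (IH (λ y → f (x ∷ y)) w) ⟩
      - dK (suppCoeffsℤ ℓ e) (λ u → f (x ∷ embed e u)) w
        ∎
      where open ≡-Reasoning

  -- Extending by zero commutes with the differentials, one coordinate e₀ = 2q + 2 of supp e at a time.
  module ExtendByZeroHead {s} (l : ℕ) (ℓ e : Vec ℕ s) (q : ℕ)
      (IH : ∀ g x → extendByZero e (dK (suppCoeffsℤ ℓ e) g) x ≡ d ℓ (extendByZero e g) x)
      (g : KCochain (suc (suppSize e))) (x : Vec ℕ s) where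
    X : ℕ
    X = suc (q ℕ.* 2)

    Ψ : Cochain (suc s)
    Ψ = extendByZero (suc X ∷ e) g

    gF gT : KCochain (suppSize e)
    gF w = g (false ∷ w)
    gT w = g (true ∷ w)

    Ψ-top : ∀ x → Ψ (suc X ∷ x) ≡ extendByZero e gF x
    Ψ-top x = choose-first (suc X ℕP.≟ suc X) (suc X ℕP.≟ X) _ _ refl

    Ψ-bottom : ∀ x → Ψ (X ∷ x) ≡ extendByZero e gT x
    Ψ-bottom x = choose-second (X ℕP.≟ suc X) (X ℕP.≟ X) _ _ (ℕP.1+n≢n ∘ sym) refl

    Ψ-off : ∀ y x → y ≢ suc X → y ≢ X → Ψ (y ∷ x) ≡ 0ℤ
    Ψ-off y x = choose-neither (y ℕP.≟ suc X) (y ℕP.≟ X) _ _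

    at-top : extendByZero (suc X ∷ e) (dK (suppCoeffsℤ (l ∷ ℓ) (suc X ∷ e)) g) (suc X ∷ x) ≡ d (l ∷ ℓ) Ψ (suc X ∷ x)
    at-top = begin
      _ ≡⟨ choose-first (suc X ℕP.≟ suc X) (suc X ℕP.≟ X) _ _ refl ⟩
      extendByZero e (λ w → a * gT w + dK bs gF w) x
        ≡⟨ extendByZero-pointwise e _+_ refl (λ w → a * gT w) (dK bs gF) x ⟩
      extendByZero e (λ w → a * gT w) x + extendByZero e (dK bs gF) x
        ≡⟨ cong₂ _+_ (extendByZero-pointwise e (λ u _ → a * u) (ℤP.*-zeroʳ a) gT gT x) (IH gF x) ⟩
      a * extendByZero e gT x + d ℓ (extendByZero e gF) x
        ≡⟨ cong₂ _+_ (cong₂ _*_ (sym (cdiff-odd l q)) (sym (Ψ-bottom x))) (sym tail) ⟩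
      dHead l Ψ (suc X) x + sgn (suc X) * d ℓ (λ x′ → Ψ (suc X ∷ x′)) x
        ≡⟨ sym (d-∷ l ℓ Ψ (suc X) x) ⟩
      d (l ∷ ℓ) Ψ (suc X ∷ x) ∎
      where
      open ≡-Reasoning
      a = + (l ∸ 1)
      bs = suppCoeffsℤ ℓ e
      tail : sgn (suc X) * d ℓ (λ x′ → Ψ (suc X ∷ x′)) x ≡ d ℓ (extendByZero e gF) x
      tail = trans (cong₂ _*_ (sgn-even (suc q)) (d-cong ℓ _ _ Ψ-top x)) (ℤP.*-identityˡ _)

    at-bottom : extendByZero (suc X ∷ e) (dK (suppCoeffsℤ (l ∷ ℓ) (suc X ∷ e)) g) (X ∷ x) ≡ d (l ∷ ℓ) Ψ (X ∷ x)
    at-bottom = begin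
      _ ≡⟨ choose-second (X ℕP.≟ suc X) (X ℕP.≟ X) _ _ (ℕP.1+n≢n ∘ sym) refl ⟩
      extendByZero e (λ w → - dK bs gT w) x
        ≡⟨ extendByZero-pointwise e (λ u _ → - u) refl (dK bs gT) (dK bs gT) x ⟩
      - extendByZero e (dK bs gT) x
        ≡⟨ cong -_ (IH gT x) ⟩
      - d ℓ (extendByZero e gT) x
        ≡⟨ sym (trans (ℤP.+-identityˡ _) (trans (cong (_* d ℓ (extendByZero e gT) x) (sgn-odd q)) (ℤP.-1*i≡-i _))) ⟩
      0ℤ + sgn X * d ℓ (extendByZero e gT) x
        ≡⟨ cong₂ _+_ (sym head) (cong (sgn X *_) (sym (d-cong ℓ _ _ Ψ-bottom x))) ⟩
      dHead l Ψ X x + sgn X * d ℓ (λ x′ → Ψ (X ∷ x′)) x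
        ≡⟨ sym (d-∷ l ℓ Ψ X x) ⟩
      d (l ∷ ℓ) Ψ (X ∷ x) ∎
      where
      open ≡-Reasoning
      bs = suppCoeffsℤ ℓ e
      head : dHead l Ψ X x ≡ 0ℤ
      head = trans (cong (_* Ψ (q ℕ.* 2 ∷ x)) (cdiff-even l q)) (ℤP.*-zeroˡ (Ψ (q ℕ.* 2 ∷ x)))

    elsewhere : ∀ y → y ≢ suc X → y ≢ X →
      extendByZero (suc X ∷ e) (dK (suppCoeffsℤ (l ∷ ℓ) (suc X ∷ e)) g) (y ∷ x) ≡ d (l ∷ ℓ) Ψ (y ∷ x)
    elsewhere y y≢top y≢bottom = trans (choose-neither (y ℕP.≟ suc X) (y ℕP.≟ X) _ _ y≢top y≢bottom) (sym (begin
      d (l ∷ ℓ) Ψ (y ∷ x)                                  ≡⟨ d-∷ l ℓ Ψ y x ⟩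
      dHead l Ψ y x + sgn y * d ℓ (λ x′ → Ψ (y ∷ x′)) x    ≡⟨ cong₂ _+_ (head y y≢top) tail ⟩
      0ℤ                                                   ∎))
      where
      open ≡-Reasoning
      tail : sgn y * d ℓ (λ x′ → Ψ (y ∷ x′)) x ≡ 0ℤ
      tail = trans (cong (sgn y *_) (trans (d-cong ℓ _ zeroC (λ x′ → Ψ-off y x′ y≢top y≢bottom) x) (d-zero ℓ x)))
                   (ℤP.*-zeroʳ (sgn y))
      head : ∀ y → y ≢ suc X → dHead l Ψ y x ≡ 0ℤ
      head zero     _ = refl
      head (suc y′) y≢top = by-cases (y′ ℕP.≟ suc X) (y′ ℕP.≟ X)
        where
        by-cases : Dec (y′ ≡ suc X) → Dec (y′ ≡ X) → cdiff l y′ * Ψ (y′ ∷ x) ≡ 0ℤ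
        by-cases (yes refl) _        = trans (cong (_* Ψ (suc X ∷ x)) (cdiff-even l (suc q))) (ℤP.*-zeroˡ (Ψ (suc X ∷ x)))
        by-cases (no _)     (yes refl) = ⊥-elim (y≢top refl)
        by-cases (no ≢top)  (no ≢bot)  = trans (cong (cdiff l y′ *_) (Ψ-off y′ x ≢top ≢bot)) (ℤP.*-zeroʳ (cdiff l y′))

    at : ∀ y → extendByZero (suc X ∷ e) (dK (suppCoeffsℤ (l ∷ ℓ) (suc X ∷ e)) g) (y ∷ x) ≡ d (l ∷ ℓ) Ψ (y ∷ x)
    at y = by-cases (y ℕP.≟ suc X) (y ℕP.≟ X)
      where
      by-cases : Dec (y ≡ suc X) → Dec (y ≡ X) →
        extendByZero (suc X ∷ e) (dK (suppCoeffsℤ (l ∷ ℓ) (suc X ∷ e)) g) (y ∷ x) ≡ d (l ∷ ℓ) Ψ (y ∷ x)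
      by-cases (yes refl) _          = at-top
      by-cases (no _)     (yes refl) = at-bottom
      by-cases (no ≢top)  (no ≢bot)  = elsewhere y ≢top ≢bot

  extendByZero-d : ∀ {s} (ℓ e : Vec ℕ s) → Even2R e →
    ∀ g x → extendByZero e (dK (suppCoeffsℤ ℓ e) g) x ≡ d ℓ (extendByZero e g) x
  extendByZero-d []      []          _  g []          = refl
  extendByZero-d (l ∷ ℓ) (zero ∷ e)  ev g (zero ∷ x)  =
    trans (extendByZero-d ℓ e (ev ∘ suc) g x) (sym (trans (d-∷ l ℓ (extendByZero (zero ∷ e) g) 0 x) (0+1*a≡a _)))
  extendByZero-d (l ∷ ℓ) (zero ∷ e)  ev g (suc y ∷ x) = sym (trans (d-∷ l ℓ Ψ (suc y) x)
    (cong₂ _+_ (head y) (trans (cong (sgn (suc y) *_) (d-zero ℓ x)) (ℤP.*-zeroʳ (sgn (suc y))))))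
    where
    Ψ = extendByZero (zero ∷ e) g
    head : ∀ y → cdiff l y * Ψ (y ∷ x) ≡ 0ℤ
    head zero     = refl
    head (suc y′) = ℤP.*-zeroʳ (cdiff l (suc y′))
  extendByZero-d (l ∷ ℓ) (suc x ∷ e) ev g (y ∷ x′) with even-pred-odd x (ev zero)
  ... | q , refl = ExtendByZeroHead.at l ℓ e q (extendByZero-d ℓ e (ev ∘ suc)) g x′ y

open CeKoszulDifferential

module BoolVectors where
  open import Data.Fin.Base using (splitAt; cast; _↑ˡ_; _↑ʳ_; join; combine; remQuot)

  weight-all-false : ∀ r → weight (V.replicate r false) ≡ 0
  weight-all-false zero    = refl
  weight-all-false (suc r) = weight-all-false r

  weight≡0⇒all-false : ∀ {r} (w : Vec Bool r) → weight w ≡ 0 → w ≡ V.replicate r false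
  weight≡0⇒all-false []          _  = refl
  weight≡0⇒all-false (false ∷ w) w0 = cong (false ∷_) (weight≡0⇒all-false w w0)

  weight≤length : ∀ {r} (w : Vec Bool r) → weight w ≤ r
  weight≤length []          = z≤n
  weight≤length (true ∷ w)  = s≤s (weight≤length w)
  weight≤length (false ∷ w) = ℕP.m≤n⇒m≤1+n (weight≤length w)

  bit : Bool → Fin 2
  bit true  = zero
  bit false = suc zero

  unbit : Fin 2 → Bool
  unbit zero       = true
  unbit (suc zero) = false

  unbit-bit : ∀ b → unbit (bit b) ≡ b
  unbit-bit true  = refl
  unbit-bit false = refl

  bit-unbit : ∀ i → bit (unbit i) ≡ i
  bit-unbit zero       = refl
  bit-unbit (suc zero) = refl

  indexAll : ∀ {r} → Vec Bool r → Fin (2 ℕ.^ r)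
  indexAll []      = zero
  indexAll (b ∷ w) = combine (bit b) (indexAll w)

  mutual
    enumAll : ∀ r → Fin (2 ℕ.^ r) → Vec Bool r
    enumAll zero    _ = []
    enumAll (suc r) i = enumAll-∷ r (remQuot (2 ℕ.^ r) i)

    enumAll-∷ : ∀ r → Fin 2 × Fin (2 ℕ.^ r) → Vec Bool (suc r)
    enumAll-∷ r (b , i) = unbit b ∷ enumAll r i

  enumAll-indexAll : ∀ {r} (w : Vec Bool r) → enumAll r (indexAll w) ≡ w
  enumAll-indexAll []      = refl
  enumAll-indexAll {suc r} (b ∷ w) =
    trans (cong (enumAll-∷ r) (FP.remQuot-combine (bit b) (indexAll w))) (cong₂ _∷_ (unbit-bit b) (enumAll-indexAll w))

  indexAll-enumAll : ∀ r i → indexAll (enumAll r i) ≡ i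
  indexAll-enumAll zero    zero = refl
  indexAll-enumAll (suc r) i = trans (via-pair (remQuot (2 ℕ.^ r) i)) (FP.combine-remQuot {2} (2 ℕ.^ r) i)
    where
    via-pair : ∀ bj → indexAll (enumAll-∷ r bj) ≡ combine (proj₁ bj) (proj₂ bj)
    via-pair (b , j) = cong₂ combine (bit-unbit b) (indexAll-enumAll r j)

  private
    pascal : ∀ r j → r C j ℕ.+ r C suc j ≡ suc r C suc j
    pascal = nCk+nC[k+1]≡[n+1]C[k+1]

  -- the vectors of weight j, enumerated by Fin (r C j) along Pascal's rule
  mutual
    enumWeight : ∀ r j → Fin (r C j) → Vec Bool r
    enumWeight zero    zero    _ = []
    enumWeight (suc r) zero    _ = V.replicate (suc r) false
    enumWeight (suc r) (suc j) i = enumWeight-∷ r j (splitAt (r C j) (cast (sym (pascal r j)) i))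

    enumWeight-∷ : ∀ r j → Fin (r C j) ⊎ Fin (r C suc j) → Vec Bool (suc r)
    enumWeight-∷ r j (inj₁ i) = true ∷ enumWeight r j i
    enumWeight-∷ r j (inj₂ i) = false ∷ enumWeight r (suc j) i

  -- z at the index of w among the vectors of weight j (junk if w has another weight)
  lookupWeight : ∀ r j → (Fin (r C j) → ℤ) → Vec Bool r → ℤ
  lookupWeight zero    zero    z []          = z zero
  lookupWeight zero    (suc j) z []          = 0ℤ
  lookupWeight (suc r) zero    z w           = z zero
  lookupWeight (suc r) (suc j) z (true ∷ w)  = lookupWeight r j (λ i → z (cast (pascal r j) (i ↑ˡ r C suc j))) w
  lookupWeight (suc r) (suc j) z (false ∷ w) = lookupWeight r (suc j) (λ i → z (cast (pascal r j) (r C j ↑ʳ i))) w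

  private
    cast-join-split : ∀ r j i {x} → splitAt (r C j) (cast (sym (pascal r j)) i) ≡ x →
      cast (pascal r j) (join (r C j) (r C suc j) x) ≡ i
    cast-join-split r j i refl =
      trans (cong (cast (pascal r j)) (FP.join-splitAt (r C j) (r C suc j) _)) (FP.cast-involutive (pascal r j) (sym (pascal r j)) i)

  lookupWeight-enumWeight : ∀ r j z i → lookupWeight r j z (enumWeight r j i) ≡ z i
  lookupWeight-enumWeight zero    zero    z zero = refl
  lookupWeight-enumWeight (suc r) zero    z zero = refl
  lookupWeight-enumWeight (suc r) (suc j) z i with splitAt (r C j) (cast (sym (pascal r j)) i) in eq
  ... | inj₁ i′ = trans (lookupWeight-enumWeight r j _ i′) (cong z (cast-join-split r j i eq))
  ... | inj₂ i′ = trans (lookupWeight-enumWeight r (suc j) _ i′) (cong z (cast-join-split r j i eq))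

  weight-enumWeight : ∀ r j i → weight (enumWeight r j i) ≡ j
  weight-enumWeight zero    zero    _ = refl
  weight-enumWeight (suc r) zero    _ = weight-all-false r
  weight-enumWeight (suc r) (suc j) i with splitAt (r C j) (cast (sym (pascal r j)) i)
  ... | inj₁ i′ = cong suc (weight-enumWeight r j i′)
  ... | inj₂ i′ = weight-enumWeight r (suc j) i′

  enumWeight-surjective : ∀ r j (w : Vec Bool r) → weight w ≡ j → ∃ λ i → enumWeight r j i ≡ w
  enumWeight-surjective zero    zero    []          _  = zero , refl
  enumWeight-surjective (suc r) zero    w           w0 = zero , sym (weight≡0⇒all-false w w0)
  enumWeight-surjective (suc r) (suc j) (true ∷ w)  eq with enumWeight-surjective r j w (ℕP.suc-injective eq)
  ... | i , refl = cast (pascal r j) (i ↑ˡ r C suc j) , cong (enumWeight-∷ r j) (begin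
    splitAt (r C j) (cast (sym (pascal r j)) (cast (pascal r j) (i ↑ˡ r C suc j)))
      ≡⟨ cong (splitAt (r C j)) (FP.cast-involutive (sym (pascal r j)) (pascal r j) _) ⟩
    splitAt (r C j) (i ↑ˡ r C suc j)
      ≡⟨ FP.splitAt-↑ˡ (r C j) i (r C suc j) ⟩
    inj₁ i ∎)
    where open ≡-Reasoning
  enumWeight-surjective (suc r) (suc j) (false ∷ w) eq with enumWeight-surjective r (suc j) w eq
  ... | i , refl = cast (pascal r j) (r C j ↑ʳ i) , cong (enumWeight-∷ r j) (begin
    splitAt (r C j) (cast (sym (pascal r j)) (cast (pascal r j) (r C j ↑ʳ i)))
      ≡⟨ cong (splitAt (r C j)) (FP.cast-involutive (sym (pascal r j)) (pascal r j) _) ⟩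
    splitAt (r C j) (r C j ↑ʳ i)
      ≡⟨ FP.splitAt-↑ʳ (r C j) (r C suc j) i ⟩
    inj₂ i ∎)
    where open ≡-Reasoning

open BoolVectors

module CohomologyOfModel where
  open import Data.Integer using (_+_; _*_; _-_)
  open import Data.Integer.Divisibility using () renaming (_∣_ to _∣ℤ_)
  import Data.Integer.Divisibility.Signed as Signed
  open import Data.Nat.Divisibility using (_∣0)

  ∣-multiple : ∀ g h → (+ g) ∣ℤ (+ g * h)
  ∣-multiple g h = Signed.∣⇒∣ᵤ (Signed.divides h (ℤP.*-comm (+ g) h))

  ∣⇒multiple : ∀ g z → (+ g) ∣ℤ z → ∃ λ h → + g * h ≡ z
  ∣⇒multiple g z g∣z with Signed.∣ᵤ⇒∣ {+ g} {z} g∣z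
  ... | Signed.divides h z≡hg = h , trans (ℤP.*-comm (+ g) h) (sym z≡hg)

  ∣-self-diff : ∀ g a → (+ g) ∣ℤ (a - a)
  ∣-self-diff g a = subst ((+ g) ∣ℤ_) (sym (ℤP.+-inverseʳ a)) (g ∣0)

  Zmod-trans : ∀ g k x y z → SubQuot._≈_ (Zmod g k) x y → SubQuot._≈_ (Zmod g k) y z → SubQuot._≈_ (Zmod g k) x z
  Zmod-trans g k x y z x≈y y≈z i = subst ((+ g) ∣ℤ_) (telescope (x i) (y i) (z i))
    (Signed.∣⇒∣ᵤ (Signed.∣m∣n⇒∣m+n (Signed.∣ᵤ⇒∣ {+ g} {x i - y i} (x≈y i))
                                   (Signed.∣ᵤ⇒∣ {+ g} {y i - z i} (y≈z i))))
    where
    telescope : ∀ a b c → (a - b) + (b - c) ≡ a - c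
    telescope = solve-∀

  dK-zeros : ∀ r y w → dK (V.replicate r 0ℤ) y w ≡ 0ℤ
  dK-zeros zero    y []          = refl
  dK-zeros (suc r) y (false ∷ w) rewrite dK-zeros r (λ u → y (false ∷ u)) w = refl
  dK-zeros (suc r) y (true ∷ w)  rewrite dK-zeros r (λ u → y (true ∷ u)) w  = refl

  dK-model-false : ∀ r g x w → dK (gcdModel (suc r) g) x (false ∷ w) ≡ + g * x (true ∷ w)
  dK-model-false r g x w rewrite dK-zeros r (λ u → x (false ∷ u)) w = ℤP.+-identityʳ _

  dK-model-true : ∀ r g x w → dK (gcdModel (suc r) g) x (true ∷ w) ≡ 0ℤ
  dK-model-true r g x w rewrite dK-zeros r (λ u → x (true ∷ u)) w = refl

  -- In K(g, 0, …, 0) (with r zeros) a cocycle vanishes on the first factor's lower degree, and its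
  -- class is its values on the upper one taken modulo g.
  module Model (r g δ : ℕ) (g≥1 : 1 ≤ g) (r<δ : r < δ) where
    M : Vec ℤ (suc r)
    M = gcdModel (suc r) g

    Cocycle : ℕ → KCochain (suc r) → Set
    Cocycle n y = eqK δ (suc n) (dK M y) zeroK

    cocycle-true : ∀ n y → Cocycle n y → ∀ w → suc n ℕ.+ weight w ≡ δ → y (true ∷ w) ≡ 0ℤ
    cocycle-true n y dy≈0 w deg≡
      with ℤP.i*j≡0⇒i≡0∨j≡0 (+ g) (trans (sym (dK-model-false r g y w)) (dy≈0 (false ∷ w) deg≡))
    ... | inj₁ g≡0 = ⊥-elim (ℕP.<⇒≢ g≥1 (sym (ℤP.+-injective g≡0)))
    ... | inj₂ y≡0 = y≡0

    coboundary-divisible : ∀ n x w → n ℕ.+ weight w ≡ δ → CobK M δ n x → (+ g) ∣ℤ x (false ∷ w)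
    coboundary-divisible zero    x w deg≡ x≈0        = subst ((+ g) ∣ℤ_) (sym (x≈0 (false ∷ w) deg≡)) (g ∣0)
    coboundary-divisible (suc n) x w deg≡ (h , dh≈x) =
      subst ((+ g) ∣ℤ_) (trans (sym (dK-model-false r g h w)) (dh≈x (false ∷ w) deg≡)) (∣-multiple g (h (true ∷ w)))

    weight<δ : ∀ (w : Vec Bool r) → weight w < δ
    weight<δ w = ℕP.≤-<-trans (weight≤length w) r<δ

    congruent⇒cohomologous : ∀ n y y′ → Cocycle n y → Cocycle n y′ →
      (∀ w → n ℕ.+ weight w ≡ δ → (+ g) ∣ℤ (y (false ∷ w) - y′ (false ∷ w))) → CobK M δ n (y ⊖K y′)
    congruent⇒cohomologous zero y y′ dy≈0 dy′≈0 _ (false ∷ w) deg≡ = ⊥-elim (ℕP.<⇒≢ (weight<δ w) deg≡)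
    congruent⇒cohomologous zero y y′ dy≈0 dy′≈0 _ (true ∷ w)  deg≡
      rewrite cocycle-true 0 y dy≈0 w deg≡ | cocycle-true 0 y′ dy′≈0 w deg≡ = refl
    congruent⇒cohomologous (suc n) y y′ dy≈0 dy′≈0 g∣y-y′ = h , dh≈y-y′
      where
      quotient : ∀ w → Dec (suc n ℕ.+ weight w ≡ δ) → ℤ
      quotient w (yes deg≡) = proj₁ (∣⇒multiple g (y (false ∷ w) - y′ (false ∷ w)) (g∣y-y′ w deg≡))
      quotient w (no _)     = 0ℤ
      quotient-spec : ∀ w deg? → suc n ℕ.+ weight w ≡ δ → + g * quotient w deg? ≡ y (false ∷ w) - y′ (false ∷ w)
      quotient-spec w (yes deg≡) _    = proj₂ (∣⇒multiple g (y (false ∷ w) - y′ (false ∷ w)) (g∣y-y′ w deg≡))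
      quotient-spec w (no deg≢)  deg≡ = ⊥-elim (deg≢ deg≡)
      h : KCochain (suc r)
      h (true ∷ w)  = quotient w (suc n ℕ.+ weight w ℕP.≟ δ)
      h (false ∷ w) = 0ℤ
      dh≈y-y′ : eqK δ (suc n) (dK M h) (y ⊖K y′)
      dh≈y-y′ (false ∷ w) deg≡ = trans (dK-model-false r g h w) (quotient-spec w (suc n ℕ.+ weight w ℕP.≟ δ) deg≡)
      dh≈y-y′ (true ∷ w)  deg≡ = trans (dK-model-true r g h w)
        (sym (cong₂ _-_ (cocycle-true (suc n) y dy≈0 w deg≡′) (cocycle-true (suc n) y′ dy′≈0 w deg≡′)))
        where
        deg≡′ : suc (suc n) ℕ.+ weight w ≡ δ
        deg≡′ = trans (cong suc (sym (ℕP.+-suc n (weight w)))) deg≡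

    trivial-outside : ∀ n → (∀ j → j ≤ r → n ℕ.+ j ≢ δ) → Trivial (HK M δ n)
    trivial-outside n off y dy≈0 = zero-CobK M δ n _ pointwise
      where
      pointwise : eqK δ n (y ⊖K zeroK) zeroK
      pointwise (false ∷ w) deg≡ = ⊥-elim (off (weight w) (weight≤length w) deg≡)
      pointwise (true ∷ w)  deg≡ rewrite cocycle-true n y dy≈0 w (trans (sym (ℕP.+-suc n (weight w))) deg≡) = refl

    lift : (Vec Bool r → ℤ) → KCochain (suc r)
    lift z (false ∷ w) = z w
    lift z (true ∷ w)  = 0ℤ

    lift-cocycle : ∀ n z → Cocycle n (lift z)
    lift-cocycle n z (false ∷ w) _ = trans (dK-model-false r g (lift z) w) (ℤP.*-zeroʳ (+ g))
    lift-cocycle n z (true ∷ w)  _ = dK-model-true r g (lift z) w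

    isoDeg : ∀ j n → j ≤ r → n ℕ.+ j ≡ δ → Iso (HK M δ n) (Zmod g (r C j))
    isoDeg j n j≤r n+j≡δ = values , record
      { mem  = λ _ _ → tt
      ; cong = λ x y _ _ x≈y i → coboundary-divisible n (x ⊖K y) (enumWeight r j i) (deg-enum i) x≈y
      ; hom  = λ x y _ _ i → ∣-self-diff g (x (false ∷ enumWeight r j i) + y (false ∷ enumWeight r j i))
      ; inj  = λ x y x∈ y∈ x≡y → congruent⇒cohomologous n x y x∈ y∈ (all-weights x y x≡y)
      ; surj = λ z _ → lift (lookupWeight r j z) , lift-cocycle n _ , λ i →
          subst (λ u → (+ g) ∣ℤ (u - z i)) (sym (lookupWeight-enumWeight r j z i)) (∣-self-diff g (z i))
      }
      where
      values : KCochain (suc r) → Fin (r C j) → ℤ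
      values y i = y (false ∷ enumWeight r j i)
      deg-enum : ∀ i → n ℕ.+ weight (enumWeight r j i) ≡ δ
      deg-enum i = trans (cong (n ℕ.+_) (weight-enumWeight r j i)) n+j≡δ
      all-weights : ∀ x y → SubQuot._≈_ (Zmod g (r C j)) (values x) (values y) →
        ∀ w → n ℕ.+ weight w ≡ δ → (+ g) ∣ℤ (x (false ∷ w) - y (false ∷ w))
      all-weights x y x≡y w deg≡ with enumWeight-surjective r j w (ℕP.+-cancelˡ-≡ n _ _ (trans deg≡ (sym n+j≡δ)))
      ... | i , refl = x≡y i

    isoTotal : Iso (HKTotal M δ) (Zmod g (2 ℕ.^ r))
    isoTotal = values , record
      { mem  = λ _ _ → tt
      ; cong = λ { (_ , G) (_ , G′) _ _ G≈G′ i → coboundary-divisible _ _ (enumAll r i) (deg-of (enumAll r i)) (G≈G′ _) }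
      ; hom  = λ { x y _ _ i → ∣-self-diff g (values x i + values y i) }
      ; inj  = λ { (_ , G) (_ , G′) (G∈ , _) (G′∈ , _) G≡G′ n →
                 congruent⇒cohomologous n (G n) (G′ n) (G∈ n) (G′∈ n) (all-vectors G G′ G≡G′ n) }
      ; surj = λ z _ → (suc δ , λ _ → lift (z ∘ indexAll)) ,
                 ((λ n → lift-cocycle n _) ,
                  (λ n δ<n → zero-CobK M δ n _ λ v deg≡ → ⊥-elim (too-high n δ<n v deg≡)) ,
                  (λ _ ¬tt → ⊥-elim (¬tt tt))) ,
                 λ i → subst (λ u → (+ g) ∣ℤ (z u - z i)) (sym (indexAll-enumAll r i)) (∣-self-diff g (z i))
      }
      where
      deg-of : ∀ w → (δ ∸ weight w) ℕ.+ weight w ≡ δ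
      deg-of w = ℕP.m∸n+n≡m (ℕP.<⇒≤ (weight<δ w))
      values : ℕ × (ℕ → KCochain (suc r)) → Fin (2 ℕ.^ r) → ℤ
      values (_ , G) i = G (δ ∸ weight (enumAll r i)) (false ∷ enumAll r i)
      all-vectors : ∀ (G G′ : ℕ → KCochain (suc r)) → SubQuot._≈_ (Zmod g (2 ℕ.^ r)) (values (0 , G)) (values (0 , G′)) →
        ∀ n w → n ℕ.+ weight w ≡ δ → (+ g) ∣ℤ (G n (false ∷ w) - G′ n (false ∷ w))
      all-vectors G G′ G≡G′ n w deg≡ = subst₂ (λ m v → (+ g) ∣ℤ (G m (false ∷ v) - G′ m (false ∷ v)))
        (trans (cong (λ v → δ ∸ weight v) (enumAll-indexAll w))
               (trans (cong (_∸ weight w) (sym deg≡)) (ℕP.m+n∸n≡m n (weight w))))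
        (enumAll-indexAll w) (G≡G′ (indexAll w))
      too-high : ∀ n → suc δ ≤ n → ∀ v → n ℕ.+ weight v ≢ δ
      too-high n δ<n v deg≡ = ℕP.n≮n δ (subst (suc δ ≤_) deg≡ (ℕP.≤-trans δ<n (ℕP.m≤m+n n (weight v))))

open CohomologyOfModel

module CohomologyOfCe where
  open import Data.Integer using (_+_; _-_)
  open SubQuot using (Mem)

  ceKoszulIso-basis : ∀ {s} (ℓ e : Vec ℕ s) → Even2R e → CeKoszulIso ℓ e (suppCoeffsℤ ℓ e) (deg e)
  ceKoszulIso-basis ℓ e ev = record
    { to         = λ f v → f (embed e v)
    ; from       = extendByZero e
    ; to-d       = d-embed ℓ e ev
    ; from-d     = extendByZero-d ℓ e ev
    ; to-from    = extendByZero-embed e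
    ; from-to    = from-to
    ; to-cong    = λ n f f′ f≈f′ v deg≡ → f≈f′ (embed e v) (ℕP.+-cancelʳ-≡ (weight v) _ _ (trans (deg-embed e v) (sym deg≡)))
    ; from-cong  = λ n g g′ g≈g′ x deg≡ → extendByZero-local e g g′ x λ { v refl →
                    g≈g′ v (trans (cong (ℕ._+ weight v) (sym deg≡)) (deg-embed e v)) }
    ; from-∈Ce   = extendByZero-∈Ce e
    ; to-+       = λ _ _ _ → refl
    ; to-minus   = λ _ _ _ → refl
    ; to-0       = λ _ → refl
    ; from-minus = extendByZero-pointwise e _-_ refl
    ; from-0     = extendByZero-pointwise e (λ _ _ → 0ℤ) refl zeroK zeroK
    ; from-ext   = λ g g′ g≗g′ x → extendByZero-local e g g′ x (λ v _ → g≗g′ v) }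
    where
    from-to    : ∀ n f → Cx.sub (Ce e) n f → eqS n (extendByZero e (λ v → f (embed e v))) f
    from-to n f f∈Ce x deg≡ with extendByZero-cases e x
    ... | inj₁ (x∉Ce , zero-there) = trans (zero-there _) (sym (f∈Ce x deg≡ x∉Ce))
    ... | inj₂ (v , refl , value)  = value _

  private
    null-sum : ∀ a b → a - 0ℤ + (b - 0ℤ) ≡ a + b - 0ℤ
    null-sum = solve-∀

  module _ {s} (ℓ e : Vec ℕ s) where
    H-∙-closed : ∀ n → ∙-Closed (H ℓ (Ce e) n)
    H-∙-closed n x y (x∈Ce , dx≈0) (y∈Ce , dy≈0) =
      (λ e′ deg≡ e′∉Ce → cong₂ _+_ (x∈Ce e′ deg≡ e′∉Ce) (y∈Ce e′ deg≡ e′∉Ce)) ,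
      (λ e′ deg≡ → trans (d-+ ℓ x y e′) (cong₂ _+_ (dx≈0 e′ deg≡) (dy≈0 e′ deg≡)))

    Cob-null-+ : ∀ n x y → Cob ℓ (Ce e) n (x ⊖C zeroC) → Cob ℓ (Ce e) n (y ⊖C zeroC) →
      Cob ℓ (Ce e) n ((x ⊕C y) ⊖C zeroC)
    Cob-null-+ zero    x y x≈0 y≈0 e′ deg≡ =
      trans (sym (null-sum (x e′) (y e′))) (cong₂ _+_ (x≈0 e′ deg≡) (y≈0 e′ deg≡))
    Cob-null-+ (suc n) x y (hx , hx∈ , dhx≈x) (hy , hy∈ , dhy≈y) =
      hx ⊕C hy , (λ e′ deg≡ e′∉Ce → cong₂ _+_ (hx∈ e′ deg≡ e′∉Ce) (hy∈ e′ deg≡ e′∉Ce)) ,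
      λ e′ deg≡ → trans (d-+ ℓ hx hy e′)
                        (trans (cong₂ _+_ (dhx≈x e′ deg≡) (dhy≈y e′ deg≡)) (null-sum (x e′) (y e′)))

    HTotal-∙-closed : ∙-Closed (HTotal ℓ e)
    HTotal-∙-closed = DirectSum-∙-closed (λ n → n) (λ _ → ⊤) (H ℓ (Ce e)) H-∙-closed Cob-null-+

  module _ {k} (bs : Vec ℤ k) (δ : ℕ) where
    HK-∙-closed : ∀ n → ∙-Closed (HK bs δ n)
    HK-∙-closed n x y dx≈0 dy≈0 v deg≡ = trans (dK-+ bs x y v) (cong₂ _+_ (dx≈0 v deg≡) (dy≈0 v deg≡))

    CobK-null-+ : ∀ n x y → CobK bs δ n (x ⊖K zeroK) → CobK bs δ n (y ⊖K zeroK) → CobK bs δ n ((x ⊕K y) ⊖K zeroK)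
    CobK-null-+ zero    x y x≈0 y≈0 v deg≡ = trans (sym (null-sum (x v) (y v))) (cong₂ _+_ (x≈0 v deg≡) (y≈0 v deg≡))
    CobK-null-+ (suc n) x y (hx , dhx≈x) (hy , dhy≈y) =
      hx ⊕K hy , λ v deg≡ →
        trans (dK-+ bs hx hy v) (trans (cong₂ _+_ (dhx≈x v deg≡) (dhy≈y v deg≡)) (null-sum (x v) (y v)))

    HKTotal-∙-closed : ∙-Closed (HKTotal bs δ)
    HKTotal-∙-closed = DirectSum-∙-closed (λ n → n) (λ _ → ⊤) (HK bs δ) HK-∙-closed CobK-null-+

  cohomology-via-model : ∀ {s} k (ℓ e : Vec ℕ s) g δ → CeKoszulIso ℓ e (gcdModel k g) δ → 1 ≤ k → 1 ≤ g → k ∸ 1 < δ →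
    Iso (HTotal ℓ e) (Zmod g (2 ℕ.^ (k ∸ 1)))
    × (∀ j n → j ≤ k ∸ 1 → n ℕ.+ j ≡ δ → Iso (H ℓ (Ce e) n) (Zmod g ((k ∸ 1) C j)))
    × (∀ n → (∀ j → j ≤ k ∸ 1 → n ℕ.+ j ≢ δ) → Trivial (H ℓ (Ce e) n))
  cohomology-via-model zero    ℓ e g δ iso () g≥1 r<δ
  cohomology-via-model (suc r) ℓ e g δ iso _  g≥1 r<δ =
    Iso-∘ (HTotal ℓ e) (HKTotal M δ) (Zmod g (2 ℕ.^ r)) (HTotal-∙-closed ℓ e) (HKTotal-∙-closed M δ) (Zmod-trans g _)
      (CeKoszulIso.isoTotal iso) (Model.isoTotal r g δ g≥1 r<δ) ,
    (λ j n j≤r n+j≡δ → Iso-∘ (H ℓ (Ce e) n) (HK M δ n) (Zmod g (r C j)) (H-∙-closed ℓ e n) (HK-∙-closed M δ n) (Zmod-trans g _)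
      (CeKoszulIso.isoH iso n) (Model.isoDeg r g δ g≥1 r<δ j n j≤r n+j≡δ)) ,
    (λ n off → CeKoszulIso.trivial iso n (Model.trivial-outside r g δ g≥1 r<δ n off))
    where
    M = gcdModel (suc r) g

  mgcd≡gcdAll : ∀ {s} (ℓ e : Vec ℕ s) → mgcd ℓ e ≡ gcdAll (suppCoeffs ℓ e)
  mgcd≡gcdAll []      []          = refl
  mgcd≡gcdAll (l ∷ ℓ) (zero ∷ e)  = mgcd≡gcdAll ℓ e
  mgcd≡gcdAll (l ∷ ℓ) (suc _ ∷ e) = cong (gcd (l ∸ 1)) (mgcd≡gcdAll ℓ e)

  suppCoeffs-positive : ∀ {s} (ℓ e : Vec ℕ s) → (∀ i → 2 ≤ lookup ℓ i) → All (1 ≤_) (suppCoeffs ℓ e)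
  suppCoeffs-positive []      []          _   = []
  suppCoeffs-positive (l ∷ ℓ) (zero ∷ e)  ℓ≥2 = suppCoeffs-positive ℓ e (ℓ≥2 ∘ suc)
  suppCoeffs-positive (l ∷ ℓ) (suc _ ∷ e) ℓ≥2 = ℕP.∸-monoˡ-≤ 1 (ℓ≥2 zero) ∷ suppCoeffs-positive ℓ e (ℓ≥2 ∘ suc)

  gcdAll-positive : ∀ {k} (as : Vec ℕ k) → All (1 ≤_) as → 1 ≤ k → 1 ≤ gcdAll as
  gcdAll-positive (a ∷ as) (a≥1 ∷ _) _ = ℕP.n≢0⇒n>0 (gcd[m,n]≢0 a (gcdAll as) (inj₁ (λ a≡0 → ℕP.<⇒≢ a≥1 (sym a≡0))))

  suppSize≥1 : ∀ {s} (e : Vec ℕ s) → SuppNonempty e → 1 ≤ suppSize e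
  suppSize≥1 (zero ∷ e)  (zero , e₀≢0)  = ⊥-elim (e₀≢0 refl)
  suppSize≥1 (zero ∷ e)  (suc i , eᵢ≢0) = suppSize≥1 e (i , eᵢ≢0)
  suppSize≥1 (suc _ ∷ e) _              = s≤s z≤n

  suppSize≤deg : ∀ {s} (e : Vec ℕ s) → suppSize e ≤ deg e
  suppSize≤deg []          = z≤n
  suppSize≤deg (zero ∷ e)  = suppSize≤deg e
  suppSize≤deg (suc x ∷ e) = s≤s (ℕP.≤-trans (suppSize≤deg e) (ℕP.m≤n+m (deg e) x))

  cohomology-Ce-nonempty : ∀ {s} (ℓ : Vec ℕ s) → (∀ i → 2 ≤ lookup ℓ i) → ∀ e → Even2R e → SuppNonempty e →
    Iso (HTotal ℓ e) (Zmod (mgcd ℓ e) (2 ℕ.^ (suppSize e ∸ 1)))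
    × (∀ j n → j ≤ suppSize e ∸ 1 → n ℕ.+ j ≡ deg e → Iso (H ℓ (Ce e) n) (Zmod (mgcd ℓ e) ((suppSize e ∸ 1) C j)))
    × (∀ n → (∀ j → j ≤ suppSize e ∸ 1 → n ℕ.+ j ≢ deg e) → Trivial (H ℓ (Ce e) n))
  cohomology-Ce-nonempty ℓ ℓ≥2 e ev supp≢∅ rewrite mgcd≡gcdAll ℓ e =
    cohomology-via-model (suppSize e) ℓ e (gcdAll (suppCoeffs ℓ e)) (deg e)
      (ceKoszulIso-∘ (ceKoszulIso-basis ℓ e ev) (koszulIso-gcd (suppCoeffs ℓ e) positive))
      k≥1 (gcdAll-positive (suppCoeffs ℓ e) positive k≥1)
      (ℕP.<-≤-trans (ℕP.∸-monoʳ-< {o = 0} (s≤s z≤n) k≥1) (suppSize≤deg e))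
    where
    positive = suppCoeffs-positive ℓ e ℓ≥2
    k≥1 = suppSize≥1 e supp≢∅

  lookup≤deg : ∀ {s} (e : Vec ℕ s) i → lookup e i ≤ deg e
  lookup≤deg (x ∷ e) zero    = ℕP.m≤m+n x (deg e)
  lookup≤deg (x ∷ e) (suc i) = ℕP.≤-trans (lookup≤deg e i) (ℕP.m≤n+m (deg e) x)

  deg-SuppEmpty : ∀ {s} (e : Vec ℕ s) → SuppEmpty e → deg e ≡ 0
  deg-SuppEmpty []      _      = refl
  deg-SuppEmpty (x ∷ e) supp≡∅ rewrite supp≡∅ zero = deg-SuppEmpty e (supp≡∅ ∘ suc)

  module _ {s} (ℓ e : Vec ℕ s) (ev : Even2R e) (supp≡∅ : SuppEmpty e) where
    C₀-concentrated : ∀ e′ → InBlock e e′ → deg e′ ≡ 0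
    C₀-concentrated e′ e′∈Ce = deg-SuppEmpty e′ λ i → in-C⁰ (subst (λ j → InTrunc j (lookup e′ i)) (supp≡∅ i) (e′∈Ce i))
      where
      in-C⁰ : ∀ {k} → InTrunc 0 k → k ≡ 0
      in-C⁰ (inj₁ (_ , k≡0)) = k≡0
      in-C⁰ (inj₂ (() , _))

    deg0⇒≡e : ∀ e′ → deg e′ ≡ 0 → e′ ≡ e
    deg0⇒≡e e′ deg≡0 = vec-ext e′ e λ i →
      trans (ℕP.n≤0⇒n≡0 (subst (lookup e′ i ≤_) deg≡0 (lookup≤deg e′ i))) (sym (supp≡∅ i))

    constant-∈H⁰ : ∀ z → Mem (H ℓ (Ce e) 0) (λ _ → z)
    constant-∈H⁰ z = z∈Ce , λ e′ deg≡1 → Ce-subcomplex ℓ e ev 0 (λ _ → z) z∈Ce e′ deg≡1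
                                          (λ e′∈Ce → ℕP.1+n≢0 (trans (sym deg≡1) (C₀-concentrated e′ e′∈Ce)))
      where
      z∈Ce : Cx.sub (Ce e) 0 (λ _ → z)
      z∈Ce e′ deg≡0 e′∉Ce =
        ⊥-elim (e′∉Ce (subst (InBlock e) (sym (deg0⇒≡e e′ deg≡0)) (λ i → inj₁ (supp≡∅ i , supp≡∅ i))))

    cohomology-Ce-empty : Iso (H ℓ (Ce e) 0) ZGrp × (∀ n → n ≢ 0 → Trivial (H ℓ (Ce e) n))
    cohomology-Ce-empty = ((λ f → f e) , record
      { mem  = λ _ _ → tt
      ; cong = λ x y _ _ x-y≈0 → ℤP.i-j≡0⇒i≡j (x e) (y e) (x-y≈0 e (deg-SuppEmpty e supp≡∅))
      ; hom  = λ _ _ _ _ → refl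
      ; inj  = λ x y _ _ xe≡ye e′ deg≡0 → subst (λ u → x u - y u ≡ 0ℤ) (sym (deg0⇒≡e e′ deg≡0))
                                                (trans (cong (_- y e) xe≡ye) (ℤP.+-inverseʳ (y e)))
      ; surj = λ z _ → (λ _ → z) , constant-∈H⁰ z , refl
      }) , λ n n≢0 f (f∈Ce , _) → zero-Cob ℓ e n _ λ e′ deg≡ →
        minus-zero _ (f∈Ce e′ deg≡ (λ e′∈Ce → n≢0 (trans (sym deg≡) (C₀-concentrated e′ e′∈Ce))))

open CohomologyOfCe

open import Data.Nat using (_+_; _^_)
open import Data.Nat.Divisibility using (_∣_)

mainTheorem5 : (s : ℕ) (ℓ : Vec ℕ s) →
  (∀ i → Prime (lookup ℓ i)) →
  (∀ i → ¬ (2 ∣ lookup ℓ i)) →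
  (∀ i j → lookup ℓ i ≡ lookup ℓ j → i ≡ j) →
  -- C_e is a subcomplex of C_S for e ∈ 2R
  (∀ e → Even2R e → ∀ n f → Cx.sub (Ce e) n f → Cx.sub (Ce e) (suc n) (d ℓ f))
  -- 1) C_S = ⊕_{e ∈ 2R} C_e
  × (∀ n → IsIso (CeSum {s} Even2R n) (CochainGrp (CS {s}) n) sumMap)
  -- kernel of the projection C_S → C_T
  × (∀ (T : Subset s) n f →
       (Cx.eq (CT T) n f zeroC →
          ∃ λ x → SubQuot.Mem (CeSum (λ e → Even2R e × ¬ SuppIn e T) n) x × eqS n (sumMap x) f)
       × ((∃ λ x → SubQuot.Mem (CeSum (λ e → Even2R e × ¬ SuppIn e T) n) x × eqS n (sumMap x) f) →
          Cx.eq (CT T) n f zeroC))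
  -- the projection restricts to ⊕_{e ∈ 2R, supp e ⊆ T} C_e ≅ C_T
  × (∀ (T : Subset s) n →
       IsIso (CeSum (λ e → Even2R e × SuppIn e T) n) (CochainGrp (CT T) n) sumMap)
  -- H^n(G_T, ℤ) = H^n(C_T) ≅ ⊕_{e ∈ 2R, supp e ⊆ T} H^n(C_e)
  × (∀ (T : Subset s) n →
       Iso (H ℓ (CT T) n) (HeSum ℓ (λ e → Even2R e × SuppIn e T) n))
  -- 2a)
  × (∀ e → Even2R e → SuppNonempty e →
       Iso (HTotal ℓ e) (Zmod (mgcd ℓ e) (2 ^ (suppSize e ∸ 1)))
       × (∀ j n → j ≤ suppSize e ∸ 1 → n + j ≡ deg e →
            Iso (H ℓ (Ce e) n) (Zmod (mgcd ℓ e) ((suppSize e ∸ 1) C j)))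
       × (∀ n → (∀ j → j ≤ suppSize e ∸ 1 → n + j ≢ deg e) →
            Trivial (H ℓ (Ce e) n)))
  -- 2b)
  × (∀ e → Even2R e → SuppEmpty e →
       Iso (H ℓ (Ce e) 0) ZGrp
       × (∀ n → n ≢ 0 → Trivial (H ℓ (Ce e) n)))
mainTheorem5 s ℓ prime _ _ =
  Ce-subcomplex ℓ ,
  isoCS s ,
  projection-kernel s ,
  isoCT s ,
  isoHCT ℓ ,
  cohomology-Ce-nonempty ℓ ℓ≥2 ,
  cohomology-Ce-empty ℓ
  where
  ℓ≥2 : ∀ i → 2 ≤ lookup ℓ i
  ℓ≥2 i = ℕ.nonTrivial⇒n>1 _ {{prime⇒nonTrivial (prime i)}}
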